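{- Let $G$ be a mixed unit interval graph and let $\mathcal{B}=\langle B_{i,j}\rangle_{1\le j\le k,\,1\le i\le r_j}$ be a $\mathcal{U}$-bubble model for $G$ with $k$ columns, and let $r=\max\{r_j:1\le j\le k\}$ be the length of a longest column. Then $\mathrm{cwd}(G)\le\min\{k+3,\ 2r+2\}$.
   Context: Clique-width: $\mathrm{cwd}(G)$ is the smallest $k$ such that $G$ can be constructed using at most $k$ labels by the operations: creating a single vertex with label $i$; disjoint union; relabeling all labels $i$ to $j$; and, for $i\ne j$, adding all edges between vertices labelled $i$ and vertices labelled $j$. A mixed unit interval graph is an intersection graph of unit intervals, each closed, open or half-open. A 2-dimensional $\mathcal{U}$-bubble structure for a finite nonempty set $A$ is a family $\mathcal{B}=\langle B_{i,j}\rangle_{1\le j\le k,\,1\le i\le r_j}$ of pairwise disjoint (possibly empty) sets ("bubbles") with union $A$, each partitioned into quadrants $B_{i,j}=B^{++}_{i,j}\cup B^{+- }_{i,j}\cup B^{ -+}_{i,j}\cup B^{ -- }_{i,j}$; $B^{*+}_{i,j}=B^{++}_{i,j}\cup B^{ -+}_{i,j}$, $B^{+*}_{i,j}=B^{++}_{i,j}\cup B^{+- }_{i,j}$. Column $j$ consists of the bubbles with second index $j$; row $i$ of those with first index $i$. The graph $G(\mathcal{B})$ has vertex set $A$, and distinct $u,v$ are adjacent iff, for some ordering, $u\in B_{i,j}$, $v\in B_{i',j'}$ and: (a) $j=j'$; or (b) $j=j'-1$ and $i>i'$; or (c) $j=j'-1$, $i=i'$, $u\in B^{*+}_{i,j}$,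 $v\in B^{+*}_{i',j'}$. A $\mathcal{U}$-bubble model of $G$ is such a structure for $V(G)$ with $G\cong G(\mathcal{B})$, every row and column containing a nonempty bubble, $B_{r_j,j}\ne\emptyset$ for all $j$, and with $\mathrm{top}(j)=\min\{i:B_{i,j}\ne\emptyset\}$, $\mathrm{top}(1)=1$, $\mathrm{top}(j)\le \mathrm{top}(j+1)$.
   Formalization: The unit intervals representing G as a mixed unit interval graph have rational endpoints, and each intersection of two of them is witnessed by a rational point. -}

module Defs where

open import Data.Nat using (ℕ; zero; suc; _+_; _*_; _≤_; _<_; _⊔_; _⊓_)
open import Data.Fin using (Fin; toℕ; splitAt; _≟_)
import Data.Fin as F
open import Data.Bool using (Bool; true; false; _∨_; _∧_; if_then_else_)
open import Data.Sum using (_⊎_; inj₁; inj₂)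
open import Data.Product using (Σ; ∃; _×_; _,_)
open import Relation.Nullary using (¬_)
open import Relation.Nullary.Decidable using (⌊_⌋)
open import Relation.Binary.PropositionalEquality using (_≡_; _≢_)
open import Function.Bundles using (_↔_; Inverse; _⇔_)
import Data.Rational as Q

record Graph (n : ℕ) : Set where
  field
    adj     : Fin n → Fin n → Bool
    adj-sym : ∀ u v → adj u v ≡ adj v u
    adj-irr : ∀ v → adj v v ≡ false
open Graph public

data CWExpr (k : ℕ) : ℕ → Set where
  vertex  : Fin k → CWExpr k 1
  union   : ∀ {m n} → CWExpr k m → CWExpr k n → CWExpr k (m + n)
  relabel : ∀ {n} → Fin k → Fin k → CWExpr k n → CWExpr k n
  join    : ∀ {n} (i j : Fin k) → i ≢ j → CWExpr k n → CWExpr k n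

_==_ : ∀ {k} → Fin k → Fin k → Bool
a == b = ⌊ a ≟ b ⌋

label : ∀ {k n} → CWExpr k n → Fin n → Fin k
label (vertex i) _ = i
label (union {m} e f) v with splitAt m v
... | inj₁ a = label e a
... | inj₂ b = label f b
label (relabel i j e) v = if label e v == i then j else label e v
label (join i j _ e) v = label e v

eadj : ∀ {k n} → CWExpr k n → Fin n → Fin n → Bool
eadj (vertex i) _ _ = false
eadj (union {m} e f) u v with splitAt m u | splitAt m v
... | inj₁ a | inj₁ b = eadj e a b
... | inj₂ a | inj₂ b = eadj f a b
... | inj₁ _ | inj₂ _ = false
... | inj₂ _ | inj₁ _ = false
eadj (relabel i j e) u v = eadj e u v
eadj (join i j _ e) u v =
  eadj e u v
  ∨ ((label e u == i) ∧ (label e v == j))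
  ∨ ((label e u == j) ∧ (label e v == i))

Realizes : ∀ {k n} → CWExpr k n → Graph n → Set
Realizes {n = n} e G =
  Σ (Fin n ↔ Fin n) λ π →
    ∀ u v → adj G u v ≡ eadj e (Inverse.to π u) (Inverse.to π v)

CwdAtMost : ∀ {n} → Graph n → ℕ → Set
CwdAtMost {n} G k = Σ (CWExpr k n) λ e → Realizes e G

data IntervalKind : Set where
  closedI openI leftOpen rightOpen : IntervalKind

record UnitInterval : Set where
  constructor unitInterval
  field
    kind : IntervalKind
    left : Q.ℚ

_∈I_ : Q.ℚ → UnitInterval → Set
x ∈I unitInterval closedI   a = (a Q.≤ x) × (x Q.≤ a Q.+ Q.1ℚ)
x ∈I unitInterval openI     a = (a Q.< x) × (x Q.< a Q.+ Q.1ℚ)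
x ∈I unitInterval leftOpen  a = (a Q.< x) × (x Q.≤ a Q.+ Q.1ℚ)
x ∈I unitInterval rightOpen a = (a Q.≤ x) × (x Q.< a Q.+ Q.1ℚ)

Intersect : UnitInterval → UnitInterval → Set
Intersect I J = ∃ λ x → (x ∈I I) × (x ∈I J)

IsMixedUnitIntervalGraph : ∀ {n} → Graph n → Set
IsMixedUnitIntervalGraph {n} G =
  Σ (Fin n → UnitInterval) λ f →
    ∀ u v → u ≢ v → (adj G u v ≡ true) ⇔ Intersect (f u) (f v)

-- Indices are 0-based: column j ∈ Fin k stands for column j+1 of the
-- paper, row i ∈ Fin (r j) for row i+1.  Each vertex lies in exactly one
-- bubble and in exactly one quadrant of it (signs (s₁,s₂) ↦ B^{s₁s₂}).

data Sign : Set where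
  plus minus : Sign

record BubbleStructure (n : ℕ) : Set where
  field
    k    : ℕ
    r    : Fin k → ℕ
    col  : Fin n → Fin k
    row  : (v : Fin n) → Fin (r (col v))
    sgn₁ : Fin n → Sign
    sgn₂ : Fin n → Sign
open BubbleStructure public

rowℕ : ∀ {n} (B : BubbleStructure n) → Fin n → ℕ
rowℕ B v = toℕ (row B v)

BRel : ∀ {n} (B : BubbleStructure n) → Fin n → Fin n → Set
BRel B u v =
  (col B u ≡ col B v)
  ⊎ ((suc (toℕ (col B u)) ≡ toℕ (col B v)) × (rowℕ B v < rowℕ B u))
  ⊎ ((suc (toℕ (col B u)) ≡ toℕ (col B v)) × (rowℕ B u ≡ rowℕ B v)
       × (sgn₂ B u ≡ plus) × (sgn₁ B v ≡ plus))

BAdj : ∀ {n} (B : BubbleStructure n) → Fin n → Fin n → Set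
BAdj B u v = u ≢ v × (BRel B u v ⊎ BRel B v u)

maxOver : (k : ℕ) → (Fin k → ℕ) → ℕ
maxOver zero    f = 0
maxOver (suc k) f = f F.zero ⊔ maxOver k (λ j → f (F.suc j))

maxColumnLength : ∀ {n} → BubbleStructure n → ℕ
maxColumnLength B = maxOver (k B) (r B)

record IsUBubbleModel {n} (G : Graph n) (B : BubbleStructure n) : Set where
  field
    adj-correct : ∀ u v → u ≢ v → (adj G u v ≡ true) ⇔ BAdj B u v
    col-nonempty : ∀ (j : Fin (k B)) → ∃ λ v → col B v ≡ j
    row-nonempty : ∀ i → i < maxColumnLength B → ∃ λ v → rowℕ B v ≡ i
    last-nonempty : ∀ (j : Fin (k B)) →
      ∃ λ v → (col B v ≡ j) × (suc (rowℕ B v) ≡ r B j)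
    top-first : ∀ (j : Fin (k B)) → toℕ j ≡ 0 →
      ∃ λ v → (col B v ≡ j) × (rowℕ B v ≡ 0)
    -- top(j) ≤ top(j+1)
    top-mono : ∀ (j j' : Fin (k B)) → suc (toℕ j) ≡ toℕ j' →
      ∀ v → col B v ≡ j' → ∃ λ u → (col B u ≡ j) × (rowℕ B u ≤ rowℕ B v)

-- Both bounds come from one linear construction. The vertices of G(B) are grouped by
-- (bubble, quadrant) and the groups are added one at a time in a fixed linear order;
-- each group is a clique, created under a fresh label, joined to every earlier vertex
-- whose current label is active for it, and afterwards all labels are updated by a few
-- relabellings. Adjacency in G(B) only involves equal or consecutive columns, so a
-- vertex's label needs little memory. Row by row (bubbles of a row from left to right),
-- a vertex only has to remember its column, plus whether it lies in the current row in
-- the current or the previous column with second sign +: k + 3 labels. Column by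
-- column, a vertex remembers its row and second sign while it can still gain
-- neighbours in the next column, and a single dead label afterwards: 2r + 2 labels.
module Submission where

open import Defs
open import Data.Nat using (ℕ; _+_; _*_; _<_; _⊓_)
open import Data.Nat using (zero; suc; _≤_; _≡ᵇ_; _<ᵇ_; z≤n; s≤s; _<?_; _∸_)
import Data.Nat.Properties as ℕₚ
open import Data.Fin as F using (Fin; toℕ; splitAt; fromℕ<; _↑ˡ_; _↑ʳ_; _≟_)
import Data.Fin.Properties as Finₚ
open import Data.Bool using (Bool; true; false; _∨_; _∧_; not; if_then_else_; T)
open import Data.Bool.Properties using (∨-assoc; ∨-comm; ∧-comm; ∨-identityʳ; ∨-zeroʳ; ∧-zeroʳ; ∧-identityʳ)
open import Data.Sum using (_⊎_; inj₁; inj₂; [_,_]′)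
open import Data.Product using (Σ; _×_; _,_; proj₁; proj₂)
open import Data.List using (List; []; _∷_; allFin; filter; lookup; length)
import Data.List.Relation.Unary.All as All
open import Data.List.Relation.Unary.All using (All; []; _∷_)
open import Data.List.Relation.Unary.Any using (index; here; there)
open import Data.List.Relation.Unary.Any.Properties using (lookup-index; ¬Any[])
open import Data.List.Relation.Unary.AllPairs using (_∷_)
open import Data.List.Relation.Unary.Unique.Propositional using (Unique)
open import Data.List.Relation.Unary.Unique.Propositional.Properties using (filter⁺; allFin⁺)
open import Data.List.Membership.Propositional using (_∈_)
open import Data.List.Membership.Propositional.Properties using (∈-allFin; ∈-filter⁺; ∈-filter⁻; ∈-lookup)
open import Data.Empty using (⊥; ⊥-elim)
open import Function using (_∘_)
open import Function.Bundles using (mk↔ₛ′; Equivalence)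
open import Relation.Nullary using (¬_; Dec; yes; no)
open import Relation.Nullary.Decidable using (dec-true; dec-false; dec-no; isYes≗does)
open import Relation.Binary.PropositionalEquality
open import Relation.Binary.Definitions using (tri<; tri≈; tri>)

==-refl : ∀ {K} (a : Fin K) → (a == a) ≡ true
==-refl a = trans (isYes≗does (a ≟ a)) (dec-true (a ≟ a) refl)

≢⇒==-false : ∀ {K} {a b : Fin K} → a ≢ b → (a == b) ≡ false
≢⇒==-false {a = a} {b} a≢b = trans (isYes≗does (a ≟ b)) (dec-false (a ≟ b) a≢b)

≡ᵇ-refl : ∀ m → (m ≡ᵇ m) ≡ true
≡ᵇ-refl m = dec-true (m ℕₚ.≟ m) refl

≟-refl : ∀ m → (m ℕₚ.≟ m) ≡ yes refl
≟-refl m = ℕₚ.≟-diag refl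

≢⇒≡ᵇ-false : ∀ {m n} → m ≢ n → (m ≡ᵇ n) ≡ false
≢⇒≡ᵇ-false {m} {n} = dec-false (m ℕₚ.≟ n)

==-toℕ : ∀ {K} (a b : Fin K) → (a == b) ≡ (toℕ a ≡ᵇ toℕ b)
==-toℕ a b with a ≟ b
... | yes refl = sym (≡ᵇ-refl (toℕ a))
... | no a≢b = sym (≢⇒≡ᵇ-false (a≢b ∘ Finₚ.toℕ-injective))

false≢true : false ≢ true
false≢true ()

n≢1+n : ∀ {n} → n ≢ suc n
n≢1+n ()

n≢2+n : ∀ {n} → n ≢ suc (suc n)
n≢2+n ()

*+-mono-< : ∀ {m x y r} s → r < m → x < y → x * m + r < y * m + s
*+-mono-< {m} {x} {y} {r} s r<m x<y =
  ℕₚ.<-≤-trans (ℕₚ.+-monoʳ-< (x * m) r<m)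
    (ℕₚ.≤-trans (ℕₚ.≤-reflexive (ℕₚ.+-comm (x * m) m))
      (ℕₚ.≤-trans (ℕₚ.*-monoˡ-≤ m x<y) (ℕₚ.m≤m+n (y * m) s)))

*+-cancel-< : ∀ {m x y r s} → r < m → s < m → x * m + r < y * m + s → x < y ⊎ (x ≡ y × r < s)
*+-cancel-< {m} {x} {y} {r} {s} r<m s<m lt with ℕₚ.<-cmp x y
... | tri< x<y _ _ = inj₁ x<y
... | tri≈ _ refl _ = inj₂ (refl , ℕₚ.+-cancelˡ-< (x * m) r s lt)
... | tri> _ _ y<x = ⊥-elim (ℕₚ.<-asym lt (*+-mono-< r s<m y<x))

*+-injective : ∀ {m x y r s} → r < m → s < m → x * m + r ≡ y * m + s → x ≡ y × r ≡ s
*+-injective {m} {x} {y} {r} {s} r<m s<m eq with ℕₚ.<-cmp x y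
... | tri< x<y _ _ = ⊥-elim (ℕₚ.<-irrefl eq (*+-mono-< s r<m x<y))
... | tri≈ _ refl _ = refl , ℕₚ.+-cancelˡ-≡ (x * m) r s eq
... | tri> _ _ y<x = ⊥-elim (ℕₚ.<-irrefl (sym eq) (*+-mono-< r s<m y<x))

maxOver-upper : ∀ k (f : Fin k → ℕ) j → f j ≤ maxOver k f
maxOver-upper (suc k) f F.zero = ℕₚ.m≤m⊔n (f F.zero) _
maxOver-upper (suc k) f (F.suc j) =
  ℕₚ.≤-trans (maxOver-upper k (f ∘ F.suc) j) (ℕₚ.m≤n⊔m (f F.zero) _)

splitAt-injective : ∀ m {k} (p q : Fin (m + k)) → splitAt m p ≡ splitAt m q → p ≡ q
splitAt-injective m {k} p q eq =
  trans (sym (Finₚ.join-splitAt m k p)) (trans (cong (F.join m k) eq) (Finₚ.join-splitAt m k q))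

lookup-injective : ∀ {A : Set} {xs : List A} → Unique xs → ∀ i j → lookup xs i ≡ lookup xs j → i ≡ j
lookup-injective (_ ∷ _) F.zero F.zero _ = refl
lookup-injective (x∉ ∷ _) F.zero (F.suc j) eq = ⊥-elim (All.lookup x∉ (∈-lookup j) eq)
lookup-injective (x∉ ∷ _) (F.suc i) F.zero eq = ⊥-elim (All.lookup x∉ (∈-lookup i) (sym eq))
lookup-injective (_ ∷ u) (F.suc i) (F.suc j) eq = cong F.suc (lookup-injective u i j eq)

eadj-irrefl : ∀ {K m} (e : CWExpr K m) p → eadj e p p ≡ false
eadj-irrefl (vertex i) p = refl
eadj-irrefl (union {m} e f) p with splitAt m p
... | inj₁ a = eadj-irrefl e a
... | inj₂ b = eadj-irrefl f b
eadj-irrefl (relabel i j e) p = eadj-irrefl e p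
eadj-irrefl (join i j i≢j e) p rewrite eadj-irrefl e p = cong₂ _∨_ (notBoth i≢j) (notBoth (i≢j ∘ sym))
  where
  notBoth : ∀ {a b} → a ≢ b → (label e p == a ∧ label e p == b) ≡ false
  notBoth {a} a≢b with label e p ≟ a
  ... | yes refl = ≢⇒==-false a≢b
  ... | no _ = refl

cwdAtMost-byEnumeration : ∀ {K m n} {G : Graph n} (e : CWExpr K m) (f : Fin m → Fin n) →
  (∀ p q → eadj e p q ≡ adj G (f p) (f q)) → (∀ p q → f p ≡ f q → p ≡ q) →
  (∀ v → Σ (Fin m) λ p → f p ≡ v) → CwdAtMost G K
cwdAtMost-byEnumeration {m = m} {n} {G} e f realizes f-injective f-onto = byBijection m≡n
  where
  f⁻¹ : Fin n → Fin m
  f⁻¹ = proj₁ ∘ f-onto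
  f∘f⁻¹ : ∀ v → f (f⁻¹ v) ≡ v
  f∘f⁻¹ = proj₂ ∘ f-onto
  m≡n : m ≡ n
  m≡n = ℕₚ.≤-antisym (Finₚ.injective⇒≤ (f-injective _ _))
                     (Finₚ.injective⇒≤ {f = f⁻¹} λ {u} {v} eq →
                        trans (sym (f∘f⁻¹ u)) (trans (cong f eq) (f∘f⁻¹ v)))
  byBijection : m ≡ n → CwdAtMost G _
  byBijection refl =
    e , mk↔ₛ′ f⁻¹ f (λ p → f-injective _ _ (f∘f⁻¹ (f p))) f∘f⁻¹ ,
    λ u v → sym (trans (realizes (f⁻¹ u) (f⁻¹ v)) (cong₂ (adj G) (f∘f⁻¹ u) (f∘f⁻¹ v)))

data OptExpr (K : ℕ) : ℕ → Set where
  empty : OptExpr K 0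
  some  : ∀ {m} → CWExpr K m → OptExpr K m

optLabel : ∀ {K m} → OptExpr K m → Fin m → Fin K
optLabel (some e) = label e

optAdj : ∀ {K m} → OptExpr K m → Fin m → Fin m → Bool
optAdj (some e) = eadj e

infixl 5 _⊕_
_⊕_ : ∀ {K m s} → OptExpr K m → CWExpr K s → CWExpr K (m + s)
empty  ⊕ e = e
some a ⊕ e = union a e

disjointAdj : ∀ {A B : Set} → (A → A → Bool) → (B → B → Bool) → A ⊎ B → A ⊎ B → Bool
disjointAdj f g (inj₁ a) (inj₁ a′) = f a a′
disjointAdj f g (inj₂ b) (inj₂ b′) = g b b′
disjointAdj f g (inj₁ _) (inj₂ _)  = false
disjointAdj f g (inj₂ _) (inj₁ _)  = false

eadj-⊕ : ∀ {K m s} (x : OptExpr K m) (e : CWExpr K s) p q →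
  eadj (x ⊕ e) p q ≡ disjointAdj (optAdj x) (eadj e) (splitAt m p) (splitAt m q)
eadj-⊕ empty e p q = refl
eadj-⊕ {m = m} (some a) e p q with splitAt m p | splitAt m q
... | inj₁ _ | inj₁ _ = refl
... | inj₁ _ | inj₂ _ = refl
... | inj₂ _ | inj₁ _ = refl
... | inj₂ _ | inj₂ _ = refl

label-⊕ : ∀ {K m s} (x : OptExpr K m) (e : CWExpr K s) p →
  label (x ⊕ e) p ≡ [ optLabel x , label e ]′ (splitAt m p)
label-⊕ empty e p = refl
label-⊕ {m = m} (some a) e p with splitAt m p
... | inj₁ _ = refl
... | inj₂ _ = refl

module _ {K : ℕ} {z w : Fin K} (w≢z : w ≢ z) where

  clique : ∀ s → CWExpr K (suc s)
  clique zero    = vertex z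
  clique (suc s) = relabel w z (join w z w≢z (union (vertex w) (clique s)))

  label-clique : ∀ s p → label (clique s) p ≡ z
  label-clique zero    p = refl
  label-clique (suc s) F.zero rewrite ==-refl w = refl
  label-clique (suc s) (F.suc p) rewrite label-clique s p with z == w
  ... | true  = refl
  ... | false = refl

  eadj-clique : ∀ s p q → p ≢ q → eadj (clique s) p q ≡ true
  eadj-clique zero F.zero F.zero p≢q = ⊥-elim (p≢q refl)
  eadj-clique (suc s) F.zero F.zero p≢q = ⊥-elim (p≢q refl)
  eadj-clique (suc s) F.zero (F.suc q) _ rewrite label-clique s q | ==-refl w | ==-refl z = refl
  eadj-clique (suc s) (F.suc p) F.zero _ rewrite label-clique s p | ==-refl w | ==-refl z = ∨-zeroʳ _
  eadj-clique (suc s) (F.suc p) (F.suc q) p≢q rewrite eadj-clique s p q (p≢q ∘ cong F.suc) = refl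

linked : ∀ {K} → Fin K → Fin K → Fin K → Fin K → Bool
linked z ℓ a b = (a == z ∧ b == ℓ) ∨ (a == ℓ ∧ b == z)

joinAll : ∀ {K m} → Fin K → (Fin K → Bool) → List (Fin K) → CWExpr K m → CWExpr K m
joinAll z P [] e = e
joinAll z P (ℓ ∷ ls) e with P ℓ | z ≟ ℓ
... | true  | no z≢ℓ = join z ℓ z≢ℓ (joinAll z P ls e)
... | true  | yes _  = joinAll z P ls e
... | false | _      = joinAll z P ls e

joinedBy : ∀ {K} → Fin K → (Fin K → Bool) → List (Fin K) → Fin K → Fin K → Bool
joinedBy z P [] a b = false
joinedBy z P (ℓ ∷ ls) a b with P ℓ | z ≟ ℓ
... | true  | no _  = linked z ℓ a b ∨ joinedBy z P ls a b
... | true  | yes _ = joinedBy z P ls a b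
... | false | _     = joinedBy z P ls a b

label-joinAll : ∀ {K m} z P ls (e : CWExpr K m) p → label (joinAll z P ls e) p ≡ label e p
label-joinAll z P [] e p = refl
label-joinAll z P (ℓ ∷ ls) e p with P ℓ | z ≟ ℓ
... | true  | no _  = label-joinAll z P ls e p
... | true  | yes _ = label-joinAll z P ls e p
... | false | _     = label-joinAll z P ls e p

eadj-joinAll : ∀ {K m} z P ls (e : CWExpr K m) p q →
  eadj (joinAll z P ls e) p q ≡ eadj e p q ∨ joinedBy z P ls (label e p) (label e q)
eadj-joinAll z P [] e p q = sym (∨-identityʳ _)
eadj-joinAll z P (ℓ ∷ ls) e p q with P ℓ | z ≟ ℓ
... | true | no _
  rewrite eadj-joinAll z P ls e p q | label-joinAll z P ls e p | label-joinAll z P ls e q =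
  trans (∨-assoc (eadj e p q) rest new) (cong (eadj e p q ∨_) (∨-comm rest new))
  where rest = joinedBy z P ls (label e p) (label e q)
        new  = linked z ℓ (label e p) (label e q)
... | true  | yes _ = eadj-joinAll z P ls e p q
... | false | _     = eadj-joinAll z P ls e p q

joinedBy-sym : ∀ {K} (z : Fin K) P ls a b → joinedBy z P ls a b ≡ joinedBy z P ls b a
joinedBy-sym z P [] a b = refl
joinedBy-sym z P (ℓ ∷ ls) a b with P ℓ | z ≟ ℓ
... | true | no _ =
  cong₂ _∨_ (trans (∨-comm (a == z ∧ b == ℓ) (a == ℓ ∧ b == z))
                   (cong₂ _∨_ (∧-comm (a == ℓ) (b == z)) (∧-comm (a == z) (b == ℓ))))
            (joinedBy-sym z P ls a b)
... | true  | yes _ = joinedBy-sym z P ls a b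
... | false | _     = joinedBy-sym z P ls a b

joinedBy-away : ∀ {K} (z : Fin K) P ls {a b} → a ≢ z → b ≢ z → joinedBy z P ls a b ≡ false
joinedBy-away z P [] a≢z b≢z = refl
joinedBy-away z P (ℓ ∷ ls) {a} a≢z b≢z with P ℓ | z ≟ ℓ
... | true | no _ rewrite ≢⇒==-false a≢z | ≢⇒==-false b≢z | ∧-zeroʳ (a == ℓ) = joinedBy-away z P ls a≢z b≢z
... | true  | yes _ = joinedBy-away z P ls a≢z b≢z
... | false | _     = joinedBy-away z P ls a≢z b≢z

joinedBy-fresh : ∀ {K} (z : Fin K) P ls → joinedBy z P ls z z ≡ false
joinedBy-fresh z P [] = refl
joinedBy-fresh z P (ℓ ∷ ls) with P ℓ | z ≟ ℓ
... | true | no z≢ℓ rewrite ==-refl z | ≢⇒==-false z≢ℓ = joinedBy-fresh z P ls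
... | true  | yes _ = joinedBy-fresh z P ls
... | false | _     = joinedBy-fresh z P ls

joinedBy-unmarked : ∀ {K} (z : Fin K) P ls {a} → a ≢ z → P a ≡ false → joinedBy z P ls a z ≡ false
joinedBy-unmarked z P [] a≢z Pa = refl
joinedBy-unmarked z P (ℓ ∷ ls) {a} a≢z Pa with P ℓ in Pℓ | z ≟ ℓ
... | true | no _ rewrite ≢⇒==-false a≢z | ==-refl z | ∧-identityʳ (a == ℓ) with a ≟ ℓ
...   | yes refl = ⊥-elim (false≢true (trans (sym Pa) Pℓ))
...   | no _     = joinedBy-unmarked z P ls a≢z Pa
joinedBy-unmarked z P (ℓ ∷ ls) a≢z Pa | true  | yes _ = joinedBy-unmarked z P ls a≢z Pa
joinedBy-unmarked z P (ℓ ∷ ls) a≢z Pa | false | _     = joinedBy-unmarked z P ls a≢z Pa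

joinedBy-marked : ∀ {K} (z : Fin K) P ls {a} → a ≢ z → P a ≡ true → a ∈ ls → joinedBy z P ls a z ≡ true
joinedBy-marked z P (a ∷ ls) a≢z Pa (here refl) with P a | z ≟ a
... | true  | no _    rewrite ==-refl a | ==-refl z | ≢⇒==-false a≢z = refl
... | true  | yes z≡a = ⊥-elim (a≢z (sym z≡a))
... | false | _       = ⊥-elim (false≢true Pa)
joinedBy-marked z P (ℓ ∷ ls) a≢z Pa (there a∈ls) with P ℓ | z ≟ ℓ
... | true  | no _  rewrite joinedBy-marked z P ls a≢z Pa a∈ls = ∨-zeroʳ _
... | true  | yes _ = joinedBy-marked z P ls a≢z Pa a∈ls
... | false | _     = joinedBy-marked z P ls a≢z Pa a∈ls

joinedBy-toFresh : ∀ {K} (z : Fin K) P {ls a} → a ≢ z → a ∈ ls → joinedBy z P ls a z ≡ P a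
joinedBy-toFresh z P {ls} {a} a≢z a∈ls with P a in Pa
... | true  = joinedBy-marked z P ls a≢z Pa a∈ls
... | false = joinedBy-unmarked z P ls a≢z Pa

joinedBy-fromFresh : ∀ {K} (z : Fin K) P {ls b} → b ≢ z → b ∈ ls → joinedBy z P ls z b ≡ P b
joinedBy-fromFresh z P {ls} {b} b≢z b∈ls = trans (joinedBy-sym z P ls z b) (joinedBy-toFresh z P b≢z b∈ls)

relabelℕ : ℕ → ℕ → ℕ → ℕ
relabelℕ a b x = if x ≡ᵇ a then b else x

applyRelabels : List (ℕ × ℕ) → ℕ → ℕ
applyRelabels []             x = x
applyRelabels ((a , b) ∷ rs) x = applyRelabels rs (relabelℕ a b x)

LabelPair : ℕ → ℕ × ℕ → Set
LabelPair K (a , b) = a < K × b < K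

relabelAll : ∀ {K m} (rs : List (ℕ × ℕ)) → All (LabelPair K) rs → CWExpr K m → CWExpr K m
relabelAll []             []                  e = e
relabelAll ((a , b) ∷ rs) ((a<K , b<K) ∷ ok) e = relabelAll rs ok (relabel (fromℕ< a<K) (fromℕ< b<K) e)

eadj-relabelAll : ∀ {K m} rs ok (e : CWExpr K m) p q → eadj (relabelAll rs ok e) p q ≡ eadj e p q
eadj-relabelAll []             []      e p q = refl
eadj-relabelAll ((a , b) ∷ rs) (_ ∷ ok) e p q = eadj-relabelAll rs ok _ p q

label-relabelAll : ∀ {K m} rs ok (e : CWExpr K m) p →
  toℕ (label (relabelAll rs ok e) p) ≡ applyRelabels rs (toℕ (label e p))
label-relabelAll []             []                  e p = refl
label-relabelAll ((a , b) ∷ rs) ((a<K , b<K) ∷ ok) e p =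
  trans (label-relabelAll rs ok _ p) (cong (applyRelabels rs) relabel-toℕ)
  where
  relabel-toℕ : toℕ (if label e p == fromℕ< a<K then fromℕ< b<K else label e p) ≡ relabelℕ a b (toℕ (label e p))
  relabel-toℕ rewrite ==-toℕ (label e p) (fromℕ< a<K) | Finₚ.toℕ-fromℕ< a<K with toℕ (label e p) ≡ᵇ a
  ... | true  = Finₚ.toℕ-fromℕ< b<K
  ... | false = refl

optRelabelAll : ∀ {K m} rs → All (LabelPair K) rs → OptExpr K m → OptExpr K m
optRelabelAll rs ok empty    = empty
optRelabelAll rs ok (some e) = some (relabelAll rs ok e)

optAdj-relabelAll : ∀ {K m} rs ok (x : OptExpr K m) p q → optAdj (optRelabelAll rs ok x) p q ≡ optAdj x p q
optAdj-relabelAll rs ok (some e) = eadj-relabelAll rs ok e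

optLabel-relabelAll : ∀ {K m} rs ok (x : OptExpr K m) p →
  toℕ (optLabel (optRelabelAll rs ok x) p) ≡ applyRelabels rs (toℕ (optLabel x p))
optLabel-relabelAll rs ok (some e) = label-relabelAll rs ok e

record Schedule {n : ℕ} (G : Graph n) (K : ℕ) : Set where
  field
    stage           : Fin n → ℕ
    stages          : ℕ
    stage<stages    : ∀ u → stage u < stages
    fresh           : ℕ
    0<fresh         : 0 < fresh
    fresh<K         : fresh < K
    relabelsAfter   : ℕ → List (ℕ × ℕ)
    relabelsAfter<K : ∀ c → All (LabelPair K) (relabelsAfter c)
    joinsAt         : ℕ → ℕ → Bool
    -- labelAt d c is the label, at the start of stage c, of the vertices created at stage d < c.
    labelAt         : ℕ → ℕ → ℕ
    labelAt-suc     : ∀ d c → d < c → labelAt d (suc c) ≡ applyRelabels (relabelsAfter c) (labelAt d c)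
    labelAt-created : ∀ c → labelAt c (suc c) ≡ applyRelabels (relabelsAfter c) fresh
    labelAt≢fresh   : ∀ d c → d < c → labelAt d c ≢ fresh
    adj-earlier     : ∀ u w → stage u < stage w → adj G u w ≡ joinsAt (stage w) (labelAt (stage u) (stage w))
    adj-sameStage   : ∀ u w → u ≢ w → stage u ≡ stage w → adj G u w ≡ true

module Construction {n K : ℕ} {G : Graph n} (S : Schedule G K) where
  open Schedule S

  freshL spareL : Fin K
  freshL = fromℕ< fresh<K
  spareL = fromℕ< (ℕₚ.<-trans 0<fresh fresh<K)

  toℕ-freshL : toℕ freshL ≡ fresh
  toℕ-freshL = Finₚ.toℕ-fromℕ< fresh<K

  spare≢fresh : spareL ≢ freshL
  spare≢fresh eq = ℕₚ.<⇒≢ 0<fresh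
    (trans (sym (Finₚ.toℕ-fromℕ< (ℕₚ.<-trans 0<fresh fresh<K))) (trans (cong toℕ eq) toℕ-freshL))

  record Prefix (c : ℕ) : Set where
    field
      size      : ℕ
      expr      : OptExpr K size
      toVertex  : Fin size → Fin n
      realizes  : ∀ p q → optAdj expr p q ≡ adj G (toVertex p) (toVertex q)
      earlier   : ∀ p → stage (toVertex p) < c
      labelled  : ∀ p → toℕ (optLabel expr p) ≡ labelAt (stage (toVertex p)) c
      injective : ∀ p q → toVertex p ≡ toVertex q → p ≡ q
      covers    : ∀ v → stage v < c → Σ (Fin size) λ p → toVertex p ≡ v

  start : Prefix 0
  start = record
    { size = 0 ; expr = empty ; toVertex = λ () ; realizes = λ () ; earlier = λ ()
    ; labelled = λ () ; injective = λ () ; covers = λ _ () }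

  module Extend (c : ℕ) (pre : Prefix c) where
    open Prefix pre

    oldLabel≢fresh : ∀ p → optLabel expr p ≢ freshL
    oldLabel≢fresh p eq = labelAt≢fresh (stage (toVertex p)) c (earlier p)
      (trans (sym (labelled p)) (trans (cong toℕ eq) toℕ-freshL))

    labelled-suc : ∀ p →
      toℕ (optLabel (optRelabelAll (relabelsAfter c) (relabelsAfter<K c) expr) p) ≡ labelAt (stage (toVertex p)) (suc c)
    labelled-suc p = begin
      toℕ (optLabel (optRelabelAll (relabelsAfter c) (relabelsAfter<K c) expr) p)
        ≡⟨ optLabel-relabelAll _ _ expr p ⟩
      applyRelabels (relabelsAfter c) (toℕ (optLabel expr p))
        ≡⟨ cong (applyRelabels (relabelsAfter c)) (labelled p) ⟩
      applyRelabels (relabelsAfter c) (labelAt (stage (toVertex p)) c)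
        ≡⟨ labelAt-suc _ c (earlier p) ⟨
      labelAt (stage (toVertex p)) (suc c) ∎
      where open ≡-Reasoning

    skipStage : (∀ v → stage v ≢ c) → Prefix (suc c)
    skipStage noneAt-c = record
      { size = size ; expr = optRelabelAll (relabelsAfter c) (relabelsAfter<K c) expr ; toVertex = toVertex
      ; realizes = λ p q → trans (optAdj-relabelAll _ _ expr p q) (realizes p q)
      ; earlier = λ p → ℕₚ.m<n⇒m<1+n (earlier p)
      ; labelled = labelled-suc ; injective = injective ; covers = covers′ }
      where
      covers′ : ∀ v → stage v < suc c → Σ (Fin size) λ p → toVertex p ≡ v
      covers′ v lt with ℕₚ.m<1+n⇒m<n∨m≡n lt
      ... | inj₁ lt′ = covers v lt′
      ... | inj₂ eq  = ⊥-elim (noneAt-c v eq)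

    module AddBlock {s : ℕ} (block : CWExpr K s) (member : Fin s → Fin n)
      (block-clique : ∀ p q → p ≢ q → eadj block p q ≡ true)
      (member-stage : ∀ p → stage (member p) ≡ c)
      (block-fresh : ∀ p → label block p ≡ freshL)
      (member-injective : ∀ p q → member p ≡ member q → p ≡ q)
      (member-covers : ∀ v → stage v ≡ c → Σ (Fin s) λ p → member p ≡ v) where

      joinsNow : Fin K → Bool
      joinsNow ℓ = joinsAt c (toℕ ℓ)

      joined expr′ : CWExpr K (size + s)
      joined = joinAll freshL joinsNow (allFin K) (expr ⊕ block)
      expr′  = relabelAll (relabelsAfter c) (relabelsAfter<K c) joined

      labelOf : Fin size ⊎ Fin s → Fin K
      labelOf = [ optLabel expr , label block ]′

      vertexOf : Fin size ⊎ Fin s → Fin n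
      vertexOf = [ toVertex , member ]′

      adj-oldNew : ∀ a b → adj G (toVertex a) (member b) ≡ joinsNow (optLabel expr a)
      adj-oldNew a b = begin
        adj G (toVertex a) (member b)
          ≡⟨ adj-earlier _ _ (subst (_ <_) (sym (member-stage b)) (earlier a)) ⟩
        joinsAt (stage (member b)) (labelAt (stage (toVertex a)) (stage (member b)))
          ≡⟨ cong (λ d → joinsAt d (labelAt _ d)) (member-stage b) ⟩
        joinsAt c (labelAt (stage (toVertex a)) c)
          ≡⟨ cong (joinsAt c) (labelled a) ⟨
        joinsNow (optLabel expr a) ∎
        where open ≡-Reasoning

      realizes-⊎ : ∀ x y →
        disjointAdj (optAdj expr) (eadj block) x y ∨ joinedBy freshL joinsNow (allFin K) (labelOf x) (labelOf y)
          ≡ adj G (vertexOf x) (vertexOf y)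
      realizes-⊎ (inj₁ a) (inj₁ a′)
        rewrite joinedBy-away freshL joinsNow (allFin K) (oldLabel≢fresh a) (oldLabel≢fresh a′)
        = trans (∨-identityʳ _) (realizes a a′)
      realizes-⊎ (inj₂ b) (inj₂ b′) rewrite block-fresh b | block-fresh b′ | joinedBy-fresh freshL joinsNow (allFin K)
        with b F.≟ b′
      ... | yes refl rewrite eadj-irrefl block b = sym (adj-irr G (member b))
      ... | no b≢b′  = trans (∨-identityʳ _) (trans (block-clique b b′ b≢b′) (sym (adj-sameStage _ _ distinct sameStage)))
        where distinct  = b≢b′ ∘ member-injective b b′
              sameStage = trans (member-stage b) (sym (member-stage b′))
      realizes-⊎ (inj₁ a) (inj₂ b) rewrite block-fresh b =
        trans (joinedBy-toFresh freshL joinsNow (oldLabel≢fresh a) (∈-allFin _)) (sym (adj-oldNew a b))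
      realizes-⊎ (inj₂ b) (inj₁ a) rewrite block-fresh b =
        trans (joinedBy-fromFresh freshL joinsNow (oldLabel≢fresh a) (∈-allFin _))
              (sym (trans (adj-sym G (member b) (toVertex a)) (adj-oldNew a b)))

      labelled-⊎ : ∀ x → applyRelabels (relabelsAfter c) (toℕ (labelOf x)) ≡ labelAt (stage (vertexOf x)) (suc c)
      labelled-⊎ (inj₁ a) rewrite labelled a = sym (labelAt-suc _ c (earlier a))
      labelled-⊎ (inj₂ b) rewrite block-fresh b | toℕ-freshL | member-stage b = sym (labelAt-created c)

      realizes′ : ∀ p q → eadj expr′ p q ≡ adj G (vertexOf (splitAt size p)) (vertexOf (splitAt size q))
      realizes′ p q
        rewrite eadj-relabelAll (relabelsAfter c) (relabelsAfter<K c) joined p q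
              | eadj-joinAll freshL joinsNow (allFin K) (expr ⊕ block) p q
              | eadj-⊕ expr block p q | label-⊕ expr block p | label-⊕ expr block q
        = realizes-⊎ (splitAt size p) (splitAt size q)

      labelled′ : ∀ p → toℕ (label expr′ p) ≡ labelAt (stage (vertexOf (splitAt size p))) (suc c)
      labelled′ p
        rewrite label-relabelAll (relabelsAfter c) (relabelsAfter<K c) joined p
              | label-joinAll freshL joinsNow (allFin K) (expr ⊕ block) p | label-⊕ expr block p
        = labelled-⊎ (splitAt size p)

      earlier′ : ∀ x → stage (vertexOf x) < suc c
      earlier′ (inj₁ a) = ℕₚ.m<n⇒m<1+n (earlier a)
      earlier′ (inj₂ b) rewrite member-stage b = ℕₚ.n<1+n c

      injective-⊎ : ∀ x y → vertexOf x ≡ vertexOf y → x ≡ y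
      injective-⊎ (inj₁ a) (inj₁ a′) eq = cong inj₁ (injective a a′ eq)
      injective-⊎ (inj₁ a) (inj₂ b)  eq = ⊥-elim (ℕₚ.<-irrefl (trans (cong stage eq) (member-stage b)) (earlier a))
      injective-⊎ (inj₂ b) (inj₁ a)  eq = ⊥-elim (ℕₚ.<-irrefl (trans (cong stage (sym eq)) (member-stage b)) (earlier a))
      injective-⊎ (inj₂ b) (inj₂ b′) eq = cong inj₂ (member-injective b b′ eq)

      covers′ : ∀ v → stage v < suc c → Σ (Fin (size + s)) λ p → vertexOf (splitAt size p) ≡ v
      covers′ v lt with ℕₚ.m<1+n⇒m<n∨m≡n lt
      ... | inj₁ lt′ with covers v lt′
      ...   | a , eq = (a ↑ˡ s) , trans (cong vertexOf (Finₚ.splitAt-↑ˡ size a s)) eq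
      covers′ v lt | inj₂ eq with member-covers v eq
      ...   | b , eq′ = (size ↑ʳ b) , trans (cong vertexOf (Finₚ.splitAt-↑ʳ size s b)) eq′

      result : Prefix (suc c)
      result = record
        { size = size + s ; expr = some expr′ ; toVertex = vertexOf ∘ splitAt size
        ; realizes = realizes′ ; earlier = earlier′ ∘ splitAt size ; labelled = labelled′
        ; injective = λ p q eq → splitAt-injective size p q (injective-⊎ _ _ eq)
        ; covers = covers′ }

    extendBy : (vs : List (Fin n)) → Unique vs →
      (∀ {v} → stage v ≡ c → v ∈ vs) → (∀ {v} → v ∈ vs → stage v ≡ c) → Prefix (suc c)
    extendBy [] _ complete _ = skipStage (λ v eq → ¬Any[] (complete eq))
    extendBy (x ∷ xs) unique complete sound =
      AddBlock.result (clique spare≢fresh (length xs)) (lookup (x ∷ xs))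
        (eadj-clique spare≢fresh (length xs)) (λ p → sound (∈-lookup p))
        (label-clique spare≢fresh (length xs)) (lookup-injective unique)
        (λ v eq → index (complete eq) , sym (lookup-index (complete eq)))

  isStage : ∀ c v → Dec (stage v ≡ c)
  isStage c v = stage v ℕₚ.≟ c

  prefix : ∀ c → Prefix c
  prefix zero    = start
  prefix (suc c) = Extend.extendBy c (prefix c) (filter (isStage c) (allFin n)) (filter⁺ (isStage c) (allFin⁺ n))
                     (λ {v} eq → ∈-filter⁺ (isStage c) (∈-allFin v) eq)
                     (λ v∈ → proj₂ (∈-filter⁻ (isStage c) {xs = allFin n} v∈))

  cwdAtMost : 0 < n → CwdAtMost G K
  cwdAtMost 0<n = finish expr toVertex realizes injective (λ v → covers v (stage<stages v))
    where
    open Prefix (prefix stages)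
    finish : ∀ {m} (x : OptExpr K m) (f : Fin m → Fin n) → (∀ p q → optAdj x p q ≡ adj G (f p) (f q)) →
             (∀ p q → f p ≡ f q → p ≡ q) → (∀ v → Σ (Fin m) λ p → f p ≡ v) → CwdAtMost G K
    finish empty    f _ _ onto with () ← proj₁ (onto (fromℕ< {m = 0} 0<n))
    finish (some e) f          = cwdAtMost-byEnumeration {G = G} e f

module Positions (width : ℕ) (0<width : 0 < width) where

  record Pos : Set where
    constructor pos
    field
      major minor quad : ℕ
  open Pos public

  InRange : Pos → Set
  InRange (pos a b q) = b < width × q < 4

  infix 4 _≺_
  _≺_ : Pos → Pos → Set
  pos a b q ≺ pos a′ b′ q′ = a < a′ ⊎ (a ≡ a′ × b < b′) ⊎ (a ≡ a′ × b ≡ b′ × q < q′)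

  nextMinor : ℕ → ℕ → Pos
  nextMinor a b with suc b <? width
  ... | yes _ = pos a (suc b) 0
  ... | no _  = pos (suc a) 0 0

  next : Pos → Pos
  next (pos a b 0)                   = pos a b 1
  next (pos a b 1)                   = pos a b 2
  next (pos a b 2)                   = pos a b 3
  next (pos a b (suc (suc (suc _)))) = nextMinor a b

  decode : ℕ → Pos
  decode zero    = pos 0 0 0
  decode (suc c) = next (decode c)

  encode : Pos → ℕ
  encode (pos a b q) = (a * width + b) * 4 + q

  next-inRange : ∀ p → InRange p → InRange (next p)
  next-inRange (pos a b 0) (b< , _) = b< , s≤s (s≤s z≤n)
  next-inRange (pos a b 1) (b< , _) = b< , s≤s (s≤s (s≤s z≤n))
  next-inRange (pos a b 2) (b< , _) = b< , s≤s (s≤s (s≤s (s≤s z≤n)))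
  next-inRange (pos a b (suc (suc (suc _)))) _ with suc b <? width
  ... | yes b+1< = b+1< , s≤s z≤n
  ... | no _     = 0<width , s≤s z≤n

  decode-inRange : ∀ c → InRange (decode c)
  decode-inRange zero    = 0<width , s≤s z≤n
  decode-inRange (suc c) = next-inRange (decode c) (decode-inRange c)

  encode-next : ∀ p → InRange p → encode (next p) ≡ suc (encode p)
  encode-next (pos a b 0) _ = ℕₚ.+-suc _ 0
  encode-next (pos a b 1) _ = ℕₚ.+-suc _ 1
  encode-next (pos a b 2) _ = ℕₚ.+-suc _ 2
  encode-next (pos a b 3) (b< , _) with suc b <? width
  ... | yes _ = begin
    (a * width + suc b) * 4 + 0  ≡⟨ ℕₚ.+-identityʳ _ ⟩
    (a * width + suc b) * 4      ≡⟨ cong (_* 4) (ℕₚ.+-suc (a * width) b) ⟩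
    suc (a * width + b) * 4      ≡⟨ ℕₚ.+-comm 4 _ ⟩
    (a * width + b) * 4 + 4      ≡⟨ ℕₚ.+-suc _ 3 ⟩
    suc ((a * width + b) * 4 + 3) ∎
    where open ≡-Reasoning
  ... | no b+1≮ = begin
    (width + a * width + 0) * 4 + 0  ≡⟨ ℕₚ.+-identityʳ _ ⟩
    (width + a * width + 0) * 4      ≡⟨ cong (_* 4) carry ⟩
    suc (a * width + b) * 4          ≡⟨ ℕₚ.+-comm 4 _ ⟩
    (a * width + b) * 4 + 4          ≡⟨ ℕₚ.+-suc _ 3 ⟩
    suc ((a * width + b) * 4 + 3)    ∎
    where
    open ≡-Reasoning
    b+1≡width : suc b ≡ width
    b+1≡width = ℕₚ.≤-antisym b< (ℕₚ.≮⇒≥ b+1≮)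
    carry : width + a * width + 0 ≡ suc (a * width + b)
    carry = begin
      width + a * width + 0  ≡⟨ ℕₚ.+-identityʳ _ ⟩
      width + a * width      ≡⟨ cong (_+ a * width) b+1≡width ⟨
      suc b + a * width      ≡⟨ cong suc (ℕₚ.+-comm b (a * width)) ⟩
      suc (a * width + b)    ∎
  encode-next (pos a b (suc (suc (suc (suc _))))) (_ , s≤s (s≤s (s≤s (s≤s ()))))

  encode-decode : ∀ c → encode (decode c) ≡ c
  encode-decode zero    = refl
  encode-decode (suc c) = trans (encode-next (decode c) (decode-inRange c)) (cong suc (encode-decode c))

  encode-injective : ∀ p p′ → InRange p → InRange p′ → encode p ≡ encode p′ → p ≡ p′
  encode-injective (pos a b q) (pos a′ b′ q′) (b< , q<) (b′< , q′<) eq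
    with *+-injective {4} {a * width + b} {a′ * width + b′} q< q′< eq
  ... | eq₁ , refl with *+-injective {width} {a} {a′} b< b′< eq₁
  ... | refl , refl = refl

  decode-encode : ∀ p → InRange p → decode (encode p) ≡ p
  decode-encode p ok = encode-injective (decode (encode p)) p (decode-inRange (encode p)) ok (encode-decode (encode p))

  encode-<⇒≺ : ∀ p p′ → InRange p → InRange p′ → encode p < encode p′ → p ≺ p′
  encode-<⇒≺ (pos a b q) (pos a′ b′ q′) (b< , q<) (b′< , q′<) lt
    with *+-cancel-< {4} {a * width + b} {a′ * width + b′} q< q′< lt
  ... | inj₂ (eq , q<q′) with *+-injective {width} {a} {a′} b< b′< eq
  ...   | refl , refl = inj₂ (inj₂ (refl , refl , q<q′))
  encode-<⇒≺ (pos a b q) (pos a′ b′ q′) (b< , q<) (b′< , q′<) lt | inj₁ lt′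
    with *+-cancel-< {width} {a} {a′} b< b′< lt′
  ... | inj₁ a<a′         = inj₁ a<a′
  ... | inj₂ (refl , b<b′) = inj₂ (inj₁ (refl , b<b′))

  decode-<⇒≺ : ∀ {d c} → d < c → decode d ≺ decode c
  decode-<⇒≺ {d} {c} d<c = encode-<⇒≺ (decode d) (decode c) (decode-inRange d) (decode-inRange c)
    (subst₂ _<_ (sym (encode-decode d)) (sym (encode-decode c)) d<c)

  encode<row : ∀ p A → InRange p → major p < A → encode p < encode (pos A 0 0)
  encode<row (pos a b q) A (b< , q<) a<A = *+-mono-< 0 q< (*+-mono-< 0 b< a<A)

  ≺⇒major≤ : ∀ {a b q a′ b′ q′} → pos a b q ≺ pos a′ b′ q′ → a ≤ a′
  ≺⇒major≤ (inj₁ a<a′)                 = ℕₚ.<⇒≤ a<a′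
  ≺⇒major≤ (inj₂ (inj₁ (refl , _)))     = ℕₚ.≤-refl
  ≺⇒major≤ (inj₂ (inj₂ (refl , _ , _))) = ℕₚ.≤-refl

  ≺-sameMajor : ∀ {a b q b′ q′} → pos a b q ≺ pos a b′ q′ → b < b′ ⊎ (b ≡ b′ × q < q′)
  ≺-sameMajor (inj₁ a<a)                   = ⊥-elim (ℕₚ.<-irrefl refl a<a)
  ≺-sameMajor (inj₂ (inj₁ (_ , b<b′)))     = inj₁ b<b′
  ≺-sameMajor (inj₂ (inj₂ (_ , refl , q<q′))) = inj₂ (refl , q<q′)

  ≺⇒minor≤ : ∀ {a b q a′ b′ q′} → a ≡ a′ → pos a b q ≺ pos a′ b′ q′ → b ≤ b′
  ≺⇒minor≤ refl lt with ≺-sameMajor lt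
  ... | inj₁ b<b′       = ℕₚ.<⇒≤ b<b′
  ... | inj₂ (refl , _) = ℕₚ.≤-refl

<⇒≡ᵇ-false : ∀ {m n} → m < n → (m ≡ᵇ n) ≡ false
<⇒≡ᵇ-false m<n = ≢⇒≡ᵇ-false (ℕₚ.<⇒≢ m<n)

>⇒≡ᵇ-false : ∀ {m n} → n < m → (m ≡ᵇ n) ≡ false
>⇒≡ᵇ-false n<m = ≢⇒≡ᵇ-false (ℕₚ.<⇒≢ n<m ∘ sym)

<⇒<ᵇ-true : ∀ {m n} → m < n → (m <ᵇ n) ≡ true
<⇒<ᵇ-true {m} {n} m<n with m <ᵇ n | ℕₚ.<⇒<ᵇ m<n
... | true | _ = refl

-- Quadrants are numbered in processing order +−, ++, −+, −−, so those with first sign + come first.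
quadrant : Sign → Sign → ℕ
quadrant plus  minus = 0
quadrant plus  plus  = 1
quadrant minus plus  = 2
quadrant minus minus = 3

quadrant<4 : ∀ s t → quadrant s t < 4
quadrant<4 plus  minus = s≤s z≤n
quadrant<4 plus  plus  = s≤s (s≤s z≤n)
quadrant<4 minus plus  = s≤s (s≤s (s≤s z≤n))
quadrant<4 minus minus = s≤s (s≤s (s≤s (s≤s z≤n)))

isPlus : Sign → Bool
isPlus plus  = true
isPlus minus = false

isPlus⇒plus : ∀ {s} → isPlus s ≡ true → s ≡ plus
isPlus⇒plus {plus} _ = refl

firstPlus secondPlus : ℕ → Bool
firstPlus 0 = true
firstPlus 1 = true
firstPlus _ = false
secondPlus 1 = true
secondPlus 2 = true
secondPlus _ = false

firstPlus-quadrant : ∀ s t → firstPlus (quadrant s t) ≡ isPlus s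
firstPlus-quadrant plus  minus = refl
firstPlus-quadrant plus  plus  = refl
firstPlus-quadrant minus plus  = refl
firstPlus-quadrant minus minus = refl

secondPlus-quadrant : ∀ s t → secondPlus (quadrant s t) ≡ isPlus t
secondPlus-quadrant plus  minus = refl
secondPlus-quadrant plus  plus  = refl
secondPlus-quadrant minus plus  = refl
secondPlus-quadrant minus minus = refl

secondMinus : ℕ → ℕ
secondMinus q = if secondPlus q then 0 else 1

secondMinus<2 : ∀ q → secondMinus q < 2
secondMinus<2 q with secondPlus q
... | true  = s≤s z≤n
... | false = s≤s (s≤s z≤n)

module BubbleModel {n : ℕ} (G : Graph n) (B : BubbleStructure n) (M : IsUBubbleModel G B) where
  open IsUBubbleModel M using (adj-correct)

  colN rowN quadN : Fin n → ℕ
  colN u = toℕ (col B u)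
  rowN u = rowℕ B u
  quadN u = quadrant (sgn₁ B u) (sgn₂ B u)

  colN<k : ∀ u → colN u < k B
  colN<k u = Finₚ.toℕ<n (col B u)

  rowN<r : ∀ u → rowN u < maxColumnLength B
  rowN<r u = ℕₚ.<-≤-trans (Finₚ.toℕ<n (row B u)) (maxOver-upper (k B) (r B) (col B u))

  quadN<4 : ∀ u → quadN u < 4
  quadN<4 u = quadrant<4 (sgn₁ B u) (sgn₂ B u)

  firstPlus⇒sgn₁ : ∀ u → firstPlus (quadN u) ≡ true → sgn₁ B u ≡ plus
  firstPlus⇒sgn₁ u eq = isPlus⇒plus (trans (sym (firstPlus-quadrant (sgn₁ B u) (sgn₂ B u))) eq)

  secondPlus⇒sgn₂ : ∀ u → secondPlus (quadN u) ≡ true → sgn₂ B u ≡ plus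
  secondPlus⇒sgn₂ u eq = isPlus⇒plus (trans (sym (secondPlus-quadrant (sgn₁ B u) (sgn₂ B u))) eq)

  sgn₁⇒firstPlus : ∀ u → sgn₁ B u ≡ plus → firstPlus (quadN u) ≡ true
  sgn₁⇒firstPlus u eq = trans (firstPlus-quadrant (sgn₁ B u) (sgn₂ B u)) (cong isPlus eq)

  sgn₂⇒secondPlus : ∀ u → sgn₂ B u ≡ plus → secondPlus (quadN u) ≡ true
  sgn₂⇒secondPlus u eq = trans (secondPlus-quadrant (sgn₁ B u) (sgn₂ B u)) (cong isPlus eq)

  adjacent : ∀ u w → u ≢ w → BRel B u w ⊎ BRel B w u → adj G u w ≡ true
  adjacent u w u≢w rel = Equivalence.from (adj-correct u w u≢w) (u≢w , rel)

  nonadjacent : ∀ u w → u ≢ w → ¬ BRel B u w → ¬ BRel B w u → adj G u w ≡ false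
  nonadjacent u w u≢w ¬uw ¬wu with adj G u w in eq
  ... | false = refl
  ... | true with Equivalence.to (adj-correct u w u≢w) eq
  ...   | _ , inj₁ uw = ⊥-elim (¬uw uw)
  ...   | _ , inj₂ wu = ⊥-elim (¬wu wu)

  sameColumn : ∀ {u w} → colN u ≡ colN w → BRel B u w
  sameColumn eq = inj₁ (Finₚ.toℕ-injective eq)

  lowerRow : ∀ {u w} → suc (colN u) ≡ colN w → rowN w < rowN u → BRel B u w
  lowerRow next lt = inj₂ (inj₁ (next , lt))

  matchingSigns : ∀ {u w} → suc (colN u) ≡ colN w → rowN u ≡ rowN w →
    sgn₂ B u ≡ plus → sgn₁ B w ≡ plus → BRel B u w
  matchingSigns next eq s₂ s₁ = inj₂ (inj₂ (next , eq , s₂ , s₁))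

  ¬BRel : ∀ {u w} → colN u ≢ colN w →
    (suc (colN u) ≡ colN w → rowN w < rowN u → ⊥) →
    (suc (colN u) ≡ colN w → rowN u ≡ rowN w → sgn₂ B u ≡ plus → sgn₁ B w ≡ plus → ⊥) →
    ¬ BRel B u w
  ¬BRel ¬same ¬lower ¬signs (inj₁ eq)                     = ¬same (cong toℕ eq)
  ¬BRel ¬same ¬lower ¬signs (inj₂ (inj₁ (next , lt)))      = ¬lower next lt
  ¬BRel ¬same ¬lower ¬signs (inj₂ (inj₂ (next , eq , s₂ , s₁))) = ¬signs next eq s₂ s₁

  ¬BRel-far : ∀ {u w} → colN u ≢ colN w → suc (colN u) ≢ colN w → ¬ BRel B u w
  ¬BRel-far ¬same ¬next = ¬BRel ¬same (λ next _ → ¬next next) (λ next _ _ _ → ¬next next)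

  ¬BRel-leftward : ∀ {u w} → colN u ≢ colN w → colN u ≤ colN w → ¬ BRel B w u
  ¬BRel-leftward ju≢jw ju≤jw = ¬BRel-far (ju≢jw ∘ sym) (λ eq → ℕₚ.<-irrefl refl (subst (_≤ _) (sym eq) ju≤jw))

  ¬BRel-secondMinus : ∀ {u w} → colN u ≢ colN w → rowN u ≡ rowN w → secondPlus (quadN u) ≡ false → ¬ BRel B u w
  ¬BRel-secondMinus ju≢jw iu≡iw s₂ = ¬BRel ju≢jw (λ _ lt → ℕₚ.<-irrefl (sym iu≡iw) lt)
    (λ _ _ s₂⁺ _ → false≢true (trans (sym s₂) (sgn₂⇒secondPlus _ s₂⁺)))

  ¬BRel-firstMinus : ∀ {u w} → colN u ≢ colN w → rowN u ≡ rowN w → firstPlus (quadN w) ≡ false → ¬ BRel B u w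
  ¬BRel-firstMinus ju≢jw iu≡iw s₁ = ¬BRel ju≢jw (λ _ lt → ℕₚ.<-irrefl (sym iu≡iw) lt)
    (λ _ _ _ s₁⁺ → false≢true (trans (sym s₁) (sgn₁⇒firstPlus _ s₁⁺)))

module RowByRow {n : ℕ} (G : Graph n) (B : BubbleStructure n) (M : IsUBubbleModel G B) (0<n : 0 < n) where
  open BubbleModel G B M

  0<k : 0 < k B
  0<k = ℕₚ.≤-<-trans z≤n (colN<k (fromℕ< {m = 0} 0<n))

  open Positions (k B) 0<k

  -- Labels below k are columns. A vertex of the current row with second sign + carries curL while
  -- its column is the current one and prevL while it is the previous one: it still awaits the
  -- vertices with first sign + of the next bubble in its row.
  prevL curL newL : ℕ
  prevL = k B
  curL  = suc (k B)
  newL  = suc (suc (k B))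

  labelBefore : Pos → Pos → ℕ
  labelBefore (pos iu ju qu) (pos ic jc qc) with iu ℕₚ.≟ ic
  ... | no _ = ju
  ... | yes _ with ju ℕₚ.≟ jc
  ...   | yes _ = if secondPlus qu then curL else ju
  ...   | no _ with suc ju ℕₚ.≟ jc
  ...     | yes _ = if secondPlus qu then prevL else ju
  ...     | no _  = ju

  afterBubble : ℕ → ℕ
  afterBubble jc with suc jc <? k B
  ... | yes _ = prevL
  ... | no _  = jc

  relabelsAfter : Pos → List (ℕ × ℕ)
  relabelsAfter (pos ic jc 0) = (newL , jc) ∷ []
  relabelsAfter (pos ic jc 1) = (newL , curL) ∷ []
  relabelsAfter (pos ic jc 2) = (newL , curL) ∷ []
  relabelsAfter (pos ic jc 3) = (newL , jc) ∷ (prevL , jc ∸ 1) ∷ (curL , afterBubble jc) ∷ []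
  relabelsAfter (pos ic jc (suc (suc (suc (suc _))))) = []

  joinsAt : Pos → ℕ → Bool
  joinsAt (pos ic jc qc) ℓ =
    (ℓ ≡ᵇ jc) ∨ ((ℓ ≡ᵇ suc jc) ∧ (suc jc <ᵇ k B)) ∨ (ℓ ≡ᵇ curL) ∨ ((ℓ ≡ᵇ prevL) ∧ firstPlus qc)

  column≡ᵇprevL : ∀ {j} → j < k B → (j ≡ᵇ prevL) ≡ false
  column≡ᵇprevL = <⇒≡ᵇ-false

  column≡ᵇcurL : ∀ {j} → j < k B → (j ≡ᵇ curL) ≡ false
  column≡ᵇcurL j<k = <⇒≡ᵇ-false (ℕₚ.<-trans j<k (ℕₚ.n<1+n (k B)))

  prevL≡ᵇcurL : (prevL ≡ᵇ curL) ≡ false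
  prevL≡ᵇcurL = <⇒≡ᵇ-false (ℕₚ.n<1+n prevL)

  curL≡ᵇprevL : (curL ≡ᵇ prevL) ≡ false
  curL≡ᵇprevL = >⇒≡ᵇ-false (ℕₚ.n<1+n prevL)

  ≤curL⇒≡ᵇnewL : ∀ {x} → x ≤ curL → (x ≡ᵇ newL) ≡ false
  ≤curL⇒≡ᵇnewL x≤ = <⇒≡ᵇ-false (s≤s x≤)

  labelBefore≤curL : ∀ pu pc → minor pu < k B → labelBefore pu pc ≤ curL
  labelBefore≤curL (pos iu ju qu) (pos ic jc qc) ju<k with iu ℕₚ.≟ ic
  ... | no _ = ℕₚ.<⇒≤ (ℕₚ.<-trans ju<k (ℕₚ.n<1+n (k B)))
  ... | yes _ with ju ℕₚ.≟ jc
  ...   | yes _ with secondPlus qu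
  ...     | true  = ℕₚ.≤-refl
  ...     | false = ℕₚ.<⇒≤ (ℕₚ.<-trans ju<k (ℕₚ.n<1+n (k B)))
  labelBefore≤curL (pos iu ju qu) (pos ic jc qc) ju<k | yes _ | no _ with suc ju ℕₚ.≟ jc
  ... | no _ = ℕₚ.<⇒≤ (ℕₚ.<-trans ju<k (ℕₚ.n<1+n (k B)))
  ... | yes _ with secondPlus qu
  ...   | true  = ℕₚ.n≤1+n (k B)
  ...   | false = ℕₚ.<⇒≤ (ℕₚ.<-trans ju<k (ℕₚ.n<1+n (k B)))

  labelBefore-quad : ∀ pu ic jc q q′ → labelBefore pu (pos ic jc q) ≡ labelBefore pu (pos ic jc q′)
  labelBefore-quad (pos iu ju qu) ic jc q q′ with iu ℕₚ.≟ ic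
  ... | no _ = refl
  ... | yes _ with ju ℕₚ.≟ jc
  ...   | yes _ = refl
  ...   | no _ with suc ju ℕₚ.≟ jc
  ...     | yes _ = refl
  ...     | no _  = refl

  relabelsAfter-last : ∀ ic jc x → x ≤ curL →
    applyRelabels (relabelsAfter (pos ic jc 3)) x ≡ relabelℕ curL (afterBubble jc) (relabelℕ prevL (jc ∸ 1) x)
  relabelsAfter-last ic jc x x≤ rewrite ≤curL⇒≡ᵇnewL x≤ = refl

  labelBefore-nextColumn : ∀ iu ju qu ic jc → ju < k B → pos iu ju qu ≺ pos ic jc 3 →
    labelBefore (pos iu ju qu) (pos ic (suc jc) 0)
      ≡ relabelℕ curL prevL (relabelℕ prevL (jc ∸ 1) (labelBefore (pos iu ju qu) (pos ic jc 3)))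
  labelBefore-nextColumn iu ju qu ic jc ju<k u≺c with iu ℕₚ.≟ ic
  ... | no _ rewrite column≡ᵇprevL ju<k | column≡ᵇcurL ju<k = refl
  ... | yes refl with ju ℕₚ.≟ jc | ju ℕₚ.≟ suc jc
  ...   | yes refl | yes eq = ⊥-elim (n≢1+n eq)
  ...   | yes refl | no _ with suc ju ℕₚ.≟ suc ju
  ...     | no ¬refl = ⊥-elim (¬refl refl)
  ...     | yes _ with secondPlus qu
  ...       | true  rewrite curL≡ᵇprevL | ≡ᵇ-refl curL = refl
  ...       | false rewrite column≡ᵇprevL ju<k | column≡ᵇcurL ju<k = refl
  labelBefore-nextColumn iu ju qu ic jc ju<k u≺c | yes refl | no _ | yes refl =
    ⊥-elim (ℕₚ.<-irrefl refl (≺⇒minor≤ refl u≺c))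
  labelBefore-nextColumn iu ju qu ic jc ju<k u≺c | yes refl | no ju≢jc | no _
    with suc ju ℕₚ.≟ jc | suc ju ℕₚ.≟ suc jc
  ... | yes refl | yes eq = ⊥-elim (n≢1+n eq)
  ... | yes refl | no _ with secondPlus qu
  ...   | true  rewrite ≡ᵇ-refl prevL | column≡ᵇcurL ju<k = refl
  ...   | false rewrite column≡ᵇprevL ju<k | column≡ᵇcurL ju<k = refl
  labelBefore-nextColumn iu ju qu ic jc ju<k u≺c | yes refl | no ju≢jc | no _ | no _ | yes eq =
    ⊥-elim (ju≢jc (ℕₚ.suc-injective eq))
  labelBefore-nextColumn iu ju qu ic jc ju<k u≺c | yes refl | no ju≢jc | no _ | no _ | no _
    rewrite column≡ᵇprevL ju<k | column≡ᵇcurL ju<k = refl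

  labelBefore-nextRow : ∀ iu ju qu ic jc → ju < k B → pos iu ju qu ≺ pos ic jc 3 →
    labelBefore (pos iu ju qu) (pos (suc ic) 0 0)
      ≡ relabelℕ curL jc (relabelℕ prevL (jc ∸ 1) (labelBefore (pos iu ju qu) (pos ic jc 3)))
  labelBefore-nextRow iu ju qu ic jc ju<k u≺c with iu ℕₚ.≟ ic | iu ℕₚ.≟ suc ic
  ... | _ | yes eq = ⊥-elim (ℕₚ.<-irrefl refl (subst (_≤ ic) eq (≺⇒major≤ u≺c)))
  ... | no _ | no _ rewrite column≡ᵇprevL ju<k | column≡ᵇcurL ju<k = refl
  ... | yes refl | no _ with ju ℕₚ.≟ jc
  ...   | yes refl with secondPlus qu
  ...     | true  rewrite curL≡ᵇprevL | ≡ᵇ-refl curL = refl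
  ...     | false rewrite column≡ᵇprevL ju<k | column≡ᵇcurL ju<k = refl
  labelBefore-nextRow iu ju qu ic jc ju<k u≺c | yes refl | no _ | no _ with suc ju ℕₚ.≟ jc
  ... | yes refl with secondPlus qu
  ...   | true  rewrite ≡ᵇ-refl prevL | column≡ᵇcurL ju<k = refl
  ...   | false rewrite column≡ᵇprevL ju<k | column≡ᵇcurL ju<k = refl
  labelBefore-nextRow iu ju qu ic jc ju<k u≺c | yes refl | no _ | no _ | no _
    rewrite column≡ᵇprevL ju<k | column≡ᵇcurL ju<k = refl

  labelBefore-next : ∀ pu pc → InRange pu → InRange pc → pu ≺ pc →
    labelBefore pu (next pc) ≡ applyRelabels (relabelsAfter pc) (labelBefore pu pc)
  labelBefore-next pu (pos ic jc 0) (ju<k , _) _ _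
    rewrite ≤curL⇒≡ᵇnewL (labelBefore≤curL pu (pos ic jc 0) ju<k) = labelBefore-quad pu ic jc 1 0
  labelBefore-next pu (pos ic jc 1) (ju<k , _) _ _
    rewrite ≤curL⇒≡ᵇnewL (labelBefore≤curL pu (pos ic jc 1) ju<k) = labelBefore-quad pu ic jc 2 1
  labelBefore-next pu (pos ic jc 2) (ju<k , _) _ _
    rewrite ≤curL⇒≡ᵇnewL (labelBefore≤curL pu (pos ic jc 2) ju<k) = labelBefore-quad pu ic jc 3 2
  labelBefore-next (pos iu ju qu) (pos ic jc 3) (ju<k , _) _ u≺c
    rewrite relabelsAfter-last ic jc _ (labelBefore≤curL (pos iu ju qu) (pos ic jc 3) ju<k)
    with suc jc <? k B
  ... | yes _ = labelBefore-nextColumn iu ju qu ic jc ju<k u≺c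
  ... | no _  = labelBefore-nextRow iu ju qu ic jc ju<k u≺c
  labelBefore-next pu (pos ic jc (suc (suc (suc (suc _))))) _ (_ , s≤s (s≤s (s≤s (s≤s ())))) _

  labelBefore-created : ∀ p → InRange p → labelBefore p (next p) ≡ applyRelabels (relabelsAfter p) newL
  labelBefore-created (pos iu ju 0) _ rewrite ≟-refl iu | ≟-refl ju | ≡ᵇ-refl newL = refl
  labelBefore-created (pos iu ju 1) _ rewrite ≟-refl iu | ≟-refl ju | ≡ᵇ-refl newL = refl
  labelBefore-created (pos iu ju 2) _ rewrite ≟-refl iu | ≟-refl ju | ≡ᵇ-refl newL = refl
  labelBefore-created (pos iu ju 3) (ju<k , _) with suc ju <? k B
  ... | yes _ rewrite ≟-refl iu | dec-no (ju ℕₚ.≟ suc ju) n≢1+n | ≟-refl (suc ju)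
                    | ≡ᵇ-refl newL | column≡ᵇprevL ju<k | column≡ᵇcurL ju<k = refl
  ... | no _ rewrite dec-no (iu ℕₚ.≟ suc iu) n≢1+n | ≡ᵇ-refl newL | column≡ᵇprevL ju<k | column≡ᵇcurL ju<k = refl
  labelBefore-created (pos iu ju (suc (suc (suc (suc _))))) (_ , s≤s (s≤s (s≤s (s≤s ()))))

  joinsAt-column : ∀ i j q → joinsAt (pos i j q) j ≡ true
  joinsAt-column i j q rewrite ≡ᵇ-refl j = refl

  joinsAt-nextColumn : ∀ i j q → suc j < k B → joinsAt (pos i j q) (suc j) ≡ true
  joinsAt-nextColumn i j q j+1<k rewrite >⇒≡ᵇ-false (ℕₚ.n<1+n j) | ≡ᵇ-refl (suc j) | <⇒<ᵇ-true j+1<k = refl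

  joinsAt-otherColumn : ∀ i j q x → x < k B → x ≢ j → x ≢ suc j → joinsAt (pos i j q) x ≡ false
  joinsAt-otherColumn i j q x x<k x≢j x≢j+1
    rewrite ≢⇒≡ᵇ-false x≢j | ≢⇒≡ᵇ-false x≢j+1 | column≡ᵇcurL x<k | column≡ᵇprevL x<k = refl

  joinsAt-curL : ∀ i j q → j < k B → joinsAt (pos i j q) curL ≡ true
  joinsAt-curL i j q j<k
    rewrite >⇒≡ᵇ-false {curL} {j} (ℕₚ.<-trans j<k (ℕₚ.n<1+n (k B))) | >⇒≡ᵇ-false {curL} {suc j} (s≤s j<k)
          | ≡ᵇ-refl curL = refl

  joinsAt-prevL : ∀ i j q → j < k B → joinsAt (pos i j q) prevL ≡ firstPlus q
  joinsAt-prevL i j q j<k rewrite >⇒≡ᵇ-false {prevL} {j} j<k | prevL≡ᵇcurL | ≡ᵇ-refl prevL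
    with suc j <ᵇ k B in j+1<ᵇk
  ... | true  rewrite >⇒≡ᵇ-false {prevL} {suc j} (ℕₚ.<ᵇ⇒< (suc j) (k B) (subst T (sym j+1<ᵇk) _)) = refl
  ... | false rewrite ∧-zeroʳ (prevL ≡ᵇ suc j) = refl

  posOf : Fin n → Pos
  posOf u = pos (rowN u) (colN u) (quadN u)

  posOf-inRange : ∀ u → InRange (posOf u)
  posOf-inRange u = colN<k u , quadN<4 u

  labelBefore-otherRow : ∀ {iu ju qu ic jc qc} → iu ≢ ic → labelBefore (pos iu ju qu) (pos ic jc qc) ≡ ju
  labelBefore-otherRow {iu} {ic = ic} iu≢ic with iu ℕₚ.≟ ic
  ... | no _    = refl
  ... | yes eq = ⊥-elim (iu≢ic eq)

  adj-earlierRow : ∀ u w → rowN u < rowN w → u ≢ w → adj G u w ≡ joinsAt (posOf w) (colN u)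
  adj-earlierRow u w iu<iw u≢w with colN u ℕₚ.≟ colN w
  ... | yes eq rewrite eq | joinsAt-column (rowN w) (colN w) (quadN w) = adjacent u w u≢w (inj₁ (sameColumn eq))
  ... | no ju≢jw with colN u ℕₚ.≟ suc (colN w)
  ...   | yes eq rewrite eq | joinsAt-nextColumn (rowN w) (colN w) (quadN w) (subst (_< k B) eq (colN<k u)) =
    adjacent u w u≢w (inj₂ (lowerRow (sym eq) iu<iw))
  ...   | no ju≢jw+1 rewrite joinsAt-otherColumn (rowN w) (colN w) (quadN w) (colN u) (colN<k u) ju≢jw ju≢jw+1 =
    nonadjacent u w u≢w (¬BRel ju≢jw (λ _ lt → ℕₚ.<-asym iu<iw lt) (λ _ eq _ _ → ℕₚ.<⇒≢ iu<iw eq))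
                        (¬BRel-far (ju≢jw ∘ sym) (ju≢jw+1 ∘ sym))

  adj-sameRow : ∀ u w → rowN u ≡ rowN w → colN u ≤ colN w → u ≢ w →
    adj G u w ≡ joinsAt (posOf w) (labelBefore (posOf u) (posOf w))
  adj-sameRow u w iu≡iw ju≤jw u≢w with rowN u ℕₚ.≟ rowN w
  ... | no iu≢iw = ⊥-elim (iu≢iw iu≡iw)
  ... | yes _ with colN u ℕₚ.≟ colN w
  ...   | yes eq with secondPlus (quadN u)
  ...     | true  rewrite joinsAt-curL (rowN w) (colN w) (quadN w) (colN<k w) = adjacent u w u≢w (inj₁ (sameColumn eq))
  ...     | false rewrite eq | joinsAt-column (rowN w) (colN w) (quadN w) = adjacent u w u≢w (inj₁ (sameColumn eq))
  adj-sameRow u w iu≡iw ju≤jw u≢w | yes _ | no ju≢jw with suc (colN u) ℕₚ.≟ colN w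
  ... | no ¬next rewrite joinsAt-otherColumn (rowN w) (colN w) (quadN w) (colN u) (colN<k u) ju≢jw
                           (λ eq → ℕₚ.<-irrefl refl (subst (_≤ colN w) eq ju≤jw)) =
    nonadjacent u w u≢w (¬BRel-far ju≢jw ¬next) (¬BRel-leftward ju≢jw ju≤jw)
  ... | yes next with secondPlus (quadN u) in s₂
  ...   | false rewrite joinsAt-otherColumn (rowN w) (colN w) (quadN w) (colN u) (colN<k u) ju≢jw
                          (λ eq → n≢2+n (trans (sym next) (cong suc eq))) =
    nonadjacent u w u≢w (¬BRel-secondMinus ju≢jw iu≡iw s₂) (¬BRel-leftward ju≢jw ju≤jw)
  ...   | true rewrite joinsAt-prevL (rowN w) (colN w) (quadN w) (colN<k w) with firstPlus (quadN w) in s₁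
  ...     | true  =
    adjacent u w u≢w (inj₁ (matchingSigns next iu≡iw (secondPlus⇒sgn₂ u s₂) (firstPlus⇒sgn₁ w s₁)))
  ...     | false = nonadjacent u w u≢w (¬BRel-firstMinus ju≢jw iu≡iw s₁) (¬BRel-leftward ju≢jw ju≤jw)

  adj≡joinsAt : ∀ u w → posOf u ≺ posOf w → u ≢ w →
    adj G u w ≡ joinsAt (posOf w) (labelBefore (posOf u) (posOf w))
  adj≡joinsAt u w u≺w u≢w with ℕₚ.m≤n⇒m<n∨m≡n (≺⇒major≤ u≺w)
  ... | inj₁ iu<iw = trans (adj-earlierRow u w iu<iw u≢w) (cong (joinsAt (posOf w)) (sym otherRow))
    where otherRow = labelBefore-otherRow {qu = quadN u} {jc = colN w} {qc = quadN w} (ℕₚ.<⇒≢ iu<iw)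
  ... | inj₂ iu≡iw = adj-sameRow u w iu≡iw (≺⇒minor≤ iu≡iw u≺w) u≢w

  newL<K : newL < k B + 3
  newL<K = subst (newL <_) (ℕₚ.+-comm 3 (k B)) (ℕₚ.n<1+n newL)

  curL<K : curL < k B + 3
  curL<K = ℕₚ.<-trans (ℕₚ.n<1+n curL) newL<K

  prevL<K : prevL < k B + 3
  prevL<K = ℕₚ.<-trans (ℕₚ.n<1+n prevL) curL<K

  column<K : ∀ {j} → j < k B → j < k B + 3
  column<K j<k = ℕₚ.<-trans j<k prevL<K

  relabelsAfter<K : ∀ p → InRange p → All (LabelPair (k B + 3)) (relabelsAfter p)
  relabelsAfter<K (pos ic jc 0) (jc<k , _) = (newL<K , column<K jc<k) ∷ []
  relabelsAfter<K (pos ic jc 1) _          = (newL<K , curL<K) ∷ []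
  relabelsAfter<K (pos ic jc 2) _          = (newL<K , curL<K) ∷ []
  relabelsAfter<K (pos ic jc 3) (jc<k , _) =
    (newL<K , column<K jc<k) ∷ (prevL<K , column<K (ℕₚ.≤-<-trans (ℕₚ.m∸n≤m jc 1) jc<k))
      ∷ (curL<K , afterBubble<K) ∷ []
    where
    afterBubble<K : afterBubble jc < k B + 3
    afterBubble<K with suc jc <? k B
    ... | yes _ = prevL<K
    ... | no _  = column<K jc<k
  relabelsAfter<K (pos ic jc (suc (suc (suc (suc _))))) (_ , s≤s (s≤s (s≤s (s≤s ()))))

  schedule : Schedule G (k B + 3)
  schedule = record
    { stage           = encode ∘ posOf
    ; stages          = encode (pos (maxColumnLength B) 0 0)
    ; stage<stages    = λ u → encode<row (posOf u) _ (posOf-inRange u) (rowN<r u)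
    ; fresh           = newL
    ; 0<fresh         = s≤s z≤n
    ; fresh<K         = newL<K
    ; relabelsAfter   = relabelsAfter ∘ decode
    ; relabelsAfter<K = λ c → relabelsAfter<K (decode c) (decode-inRange c)
    ; joinsAt         = joinsAt ∘ decode
    ; labelAt         = λ d c → labelBefore (decode d) (decode c)
    ; labelAt-suc     = λ d c d<c → labelBefore-next (decode d) (decode c) (decode-inRange d) (decode-inRange c) (decode-<⇒≺ d<c)
    ; labelAt-created = λ c → labelBefore-created (decode c) (decode-inRange c)
    ; labelAt≢fresh   = λ d c _ → ℕₚ.<⇒≢ (s≤s (labelBefore≤curL (decode d) (decode c) (proj₁ (decode-inRange d))))
    ; adj-earlier     = adj-earlier
    ; adj-sameStage   = adj-sameStage
    }
    where
    decode-posOf : ∀ u → decode (encode (posOf u)) ≡ posOf u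
    decode-posOf u = decode-encode (posOf u) (posOf-inRange u)

    adj-earlier : ∀ u w → encode (posOf u) < encode (posOf w) →
      adj G u w ≡ joinsAt (decode (encode (posOf w))) (labelBefore (decode (encode (posOf u))) (decode (encode (posOf w))))
    adj-earlier u w lt rewrite decode-posOf u | decode-posOf w =
      adj≡joinsAt u w (encode-<⇒≺ (posOf u) (posOf w) (posOf-inRange u) (posOf-inRange w) lt)
        (λ eq → ℕₚ.<-irrefl (cong (encode ∘ posOf) eq) lt)

    adj-sameStage : ∀ u w → u ≢ w → encode (posOf u) ≡ encode (posOf w) → adj G u w ≡ true
    adj-sameStage u w u≢w eq =
      adjacent u w u≢w (inj₁ (sameColumn (cong minor samePos)))
      where samePos = encode-injective (posOf u) (posOf w) (posOf-inRange u) (posOf-inRange w) eq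

module ColumnByColumn {n : ℕ} (G : Graph n) (B : BubbleStructure n) (M : IsUBubbleModel G B) (0<n : 0 < n) where
  open BubbleModel G B M

  rows : ℕ
  rows = maxColumnLength B

  0<rows : 0 < rows
  0<rows = ℕₚ.≤-<-trans z≤n (rowN<r (fromℕ< {m = 0} 0<n))

  open Positions rows 0<rows

  -- A vertex of row i carries rowL i 0 or rowL i 1 (second sign + or −) while it can still gain
  -- neighbours, and deadL afterwards.
  rowL : ℕ → ℕ → ℕ
  rowL i t = i * 2 + t

  deadL newL : ℕ
  deadL = rows * 2
  newL  = rows * 2 + 1

  labelBefore : Pos → Pos → ℕ
  labelBefore (pos ju iu qu) (pos jc ic qc) with ju ℕₚ.≟ jc
  ... | yes _ = rowL iu (secondMinus qu)
  ... | no _ with suc ju ℕₚ.≟ jc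
  ...   | no _ = deadL
  ...   | yes _ with ℕₚ.<-cmp iu ic
  ...     | tri< _ _ _ = deadL
  ...     | tri≈ _ _ _ = if secondPlus qu ∧ firstPlus qc then rowL iu 0 else deadL
  ...     | tri> _ _ _ = rowL iu (secondMinus qu)

  nextRow : ℕ → ℕ
  nextRow ic with suc ic <? rows
  ... | yes _ = suc ic
  ... | no _  = 0

  relabelsAfter : Pos → List (ℕ × ℕ)
  relabelsAfter (pos jc ic 0) = (newL , rowL ic 1) ∷ []
  relabelsAfter (pos jc ic 1) = (rowL ic 0 , deadL) ∷ (newL , rowL ic 0) ∷ []
  relabelsAfter (pos jc ic 2) = (newL , rowL ic 0) ∷ []
  relabelsAfter (pos jc ic 3) = (newL , rowL ic 1) ∷ (rowL (nextRow ic) 1 , deadL) ∷ []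
  relabelsAfter (pos jc ic (suc (suc (suc (suc _))))) = []

  alive : ℕ → Bool
  alive ℓ = not (ℓ ≡ᵇ deadL)

  rowL<deadL : ∀ {i t} → i < rows → t < 2 → rowL i t < deadL
  rowL<deadL {i} {t} i<r t<2 = subst (rowL i t <_) (ℕₚ.+-identityʳ deadL) (*+-mono-< {2} {i} {rows} {t} 0 t<2 i<r)

  deadL<newL : deadL < newL
  deadL<newL = subst (deadL <_) (ℕₚ.+-comm 1 deadL) (ℕₚ.n<1+n deadL)

  newL<K : newL < 2 * rows + 2
  newL<K = subst (λ x → newL < x + 2) (ℕₚ.*-comm rows 2) (subst (newL <_) (sym (ℕₚ.+-suc deadL 1)) (ℕₚ.n<1+n newL))

  deadL<K : deadL < 2 * rows + 2
  deadL<K = ℕₚ.<-trans deadL<newL newL<K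

  rowL<K : ∀ {i t} → i < rows → t < 2 → rowL i t < 2 * rows + 2
  rowL<K i<r t<2 = ℕₚ.<-trans (rowL<deadL i<r t<2) deadL<K

  0<2 : 0 < 2
  0<2 = s≤s z≤n

  1<2 : 1 < 2
  1<2 = s≤s (s≤s z≤n)

  rowL≡ᵇdeadL : ∀ {i t} → i < rows → t < 2 → (rowL i t ≡ᵇ deadL) ≡ false
  rowL≡ᵇdeadL i<r t<2 = <⇒≡ᵇ-false (rowL<deadL i<r t<2)

  deadL≡ᵇrowL : ∀ {i t} → i < rows → t < 2 → (deadL ≡ᵇ rowL i t) ≡ false
  deadL≡ᵇrowL i<r t<2 = >⇒≡ᵇ-false (rowL<deadL i<r t<2)

  newL≡ᵇrowL : ∀ {i t} → i < rows → t < 2 → (newL ≡ᵇ rowL i t) ≡ false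
  newL≡ᵇrowL i<r t<2 = >⇒≡ᵇ-false (ℕₚ.<-trans (rowL<deadL i<r t<2) deadL<newL)

  ≤deadL⇒≡ᵇnewL : ∀ {x} → x ≤ deadL → (x ≡ᵇ newL) ≡ false
  ≤deadL⇒≡ᵇnewL x≤ = <⇒≡ᵇ-false (ℕₚ.≤-<-trans x≤ deadL<newL)

  rowL≡ᵇrowL-row : ∀ {i i′ t t′} → t < 2 → t′ < 2 → i ≢ i′ → (rowL i t ≡ᵇ rowL i′ t′) ≡ false
  rowL≡ᵇrowL-row {i} {i′} t<2 t′<2 i≢i′ = ≢⇒≡ᵇ-false (i≢i′ ∘ proj₁ ∘ *+-injective {2} {i} {i′} t<2 t′<2)

  rowL≡ᵇrowL-sign : ∀ {i t t′} → t < 2 → t′ < 2 → t ≢ t′ → (rowL i t ≡ᵇ rowL i t′) ≡ false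
  rowL≡ᵇrowL-sign {i} t<2 t′<2 t≢t′ = ≢⇒≡ᵇ-false (t≢t′ ∘ proj₂ ∘ *+-injective {2} {i} {i} t<2 t′<2)

  labelBefore≤deadL : ∀ pu pc → minor pu < rows → labelBefore pu pc ≤ deadL
  labelBefore≤deadL (pos ju iu qu) (pos jc ic qc) iu<r with ju ℕₚ.≟ jc
  ... | yes _ = ℕₚ.<⇒≤ (rowL<deadL iu<r (secondMinus<2 qu))
  ... | no _ with suc ju ℕₚ.≟ jc
  ...   | no _ = ℕₚ.≤-refl
  ...   | yes _ with ℕₚ.<-cmp iu ic
  ...     | tri< _ _ _ = ℕₚ.≤-refl
  ...     | tri> _ _ _ = ℕₚ.<⇒≤ (rowL<deadL iu<r (secondMinus<2 qu))
  ...     | tri≈ _ _ _ with secondPlus qu ∧ firstPlus qc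
  ...       | true  = ℕₚ.<⇒≤ (rowL<deadL iu<r 0<2)
  ...       | false = ℕₚ.≤-refl

  labelBefore-quad : ∀ pu jc ic q q′ → firstPlus q ≡ firstPlus q′ →
    labelBefore pu (pos jc ic q) ≡ labelBefore pu (pos jc ic q′)
  labelBefore-quad (pos ju iu qu) jc ic q q′ eq with ju ℕₚ.≟ jc
  ... | yes _ = refl
  ... | no _ with suc ju ℕₚ.≟ jc
  ...   | no _ = refl
  ...   | yes _ with ℕₚ.<-cmp iu ic
  ...     | tri< _ _ _ = refl
  ...     | tri≈ _ _ _ rewrite eq = refl
  ...     | tri> _ _ _ = refl

  relabelsAfter-plusPlus : ∀ jc ic x → x ≤ deadL →
    applyRelabels (relabelsAfter (pos jc ic 1)) x ≡ relabelℕ (rowL ic 0) deadL x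
  relabelsAfter-plusPlus jc ic x x≤ with x ≡ᵇ rowL ic 0
  ... | true  rewrite ≤deadL⇒≡ᵇnewL {deadL} ℕₚ.≤-refl = refl
  ... | false rewrite ≤deadL⇒≡ᵇnewL x≤ = refl

  relabelsAfter-last : ∀ jc ic x → x ≤ deadL →
    applyRelabels (relabelsAfter (pos jc ic 3)) x ≡ relabelℕ (rowL (nextRow ic) 1) deadL x
  relabelsAfter-last jc ic x x≤ rewrite ≤deadL⇒≡ᵇnewL x≤ = refl

  labelBefore-nextRow : ∀ ju iu qu jc ic → suc ic < rows → pos ju iu qu ≺ pos jc ic 3 →
    labelBefore (pos ju iu qu) (pos jc (suc ic) 0)
      ≡ relabelℕ (rowL (suc ic) 1) deadL (labelBefore (pos ju iu qu) (pos jc ic 3))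
  labelBefore-nextRow ju iu qu jc ic ic+1<r u≺c with ju ℕₚ.≟ jc
  ... | yes refl
    rewrite rowL≡ᵇrowL-row (secondMinus<2 qu) 1<2 (λ eq → ℕₚ.<-irrefl refl (subst (_≤ ic) eq (≺⇒minor≤ refl u≺c))) = refl
  ... | no _ with suc ju ℕₚ.≟ jc
  ...   | no _ rewrite deadL≡ᵇrowL ic+1<r 1<2 = refl
  ...   | yes _ with ℕₚ.<-cmp iu ic | ℕₚ.<-cmp iu (suc ic)
  ...     | tri< _ _ _    | tri< _ _ _    rewrite deadL≡ᵇrowL ic+1<r 1<2 = refl
  ...     | tri< iu<ic _ _ | tri≈ _ eq _  = ⊥-elim (ℕₚ.<-irrefl refl (ℕₚ.<-trans (subst (_< ic) eq iu<ic) (ℕₚ.n<1+n ic)))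
  ...     | tri< iu<ic _ _ | tri> _ _ gt  = ⊥-elim (ℕₚ.<-asym (ℕₚ.<-trans iu<ic (ℕₚ.n<1+n ic)) gt)
  ...     | tri≈ _ refl _ | tri< _ _ _    rewrite ∧-zeroʳ (secondPlus qu) | deadL≡ᵇrowL ic+1<r 1<2 = refl
  ...     | tri≈ _ refl _ | tri≈ _ eq _   = ⊥-elim (n≢1+n eq)
  ...     | tri≈ _ refl _ | tri> _ _ gt   = ⊥-elim (ℕₚ.<-asym gt (ℕₚ.n<1+n iu))
  ...     | tri> _ _ gt   | tri< lt _ _   = ⊥-elim (ℕₚ.<-irrefl refl (ℕₚ.<-≤-trans gt (ℕₚ.≤-pred lt)))
  ...     | tri> _ _ _    | tri≈ _ refl _ rewrite ∧-identityʳ (secondPlus qu) with secondPlus qu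
  ...       | true  rewrite rowL≡ᵇrowL-sign {suc ic} 0<2 1<2 (λ ()) = refl
  ...       | false rewrite ≡ᵇ-refl (rowL (suc ic) 1) = refl
  labelBefore-nextRow ju iu qu jc ic ic+1<r u≺c | no _ | yes _ | tri> _ _ _ | tri> _ _ gt
    rewrite rowL≡ᵇrowL-row (secondMinus<2 qu) 1<2 (λ eq → ℕₚ.<-irrefl (sym eq) gt) = refl

  labelBefore-nextColumn : ∀ ju iu qu jc ic → iu < rows → ¬ suc ic < rows → pos ju iu qu ≺ pos jc ic 3 →
    labelBefore (pos ju iu qu) (pos (suc jc) 0 0)
      ≡ relabelℕ (rowL 0 1) deadL (labelBefore (pos ju iu qu) (pos jc ic 3))
  labelBefore-nextColumn ju iu qu jc ic iu<r ic+1≮r u≺c with ju ℕₚ.≟ jc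
  ... | yes refl rewrite dec-no (ju ℕₚ.≟ suc ju) n≢1+n | ≟-refl (suc ju) with ℕₚ.<-cmp iu 0
  ...   | tri≈ _ refl _ rewrite ∧-identityʳ (secondPlus qu) with secondPlus qu
  ...     | true  rewrite rowL≡ᵇrowL-sign {0} 0<2 1<2 (λ ()) = refl
  ...     | false rewrite ≡ᵇ-refl (rowL 0 1) = refl
  labelBefore-nextColumn ju iu qu jc ic iu<r ic+1≮r u≺c | yes refl | tri> _ _ 0<iu
    rewrite rowL≡ᵇrowL-row {iu} {0} (secondMinus<2 qu) 1<2 (λ eq → ℕₚ.<-irrefl (sym eq) 0<iu) = refl
  labelBefore-nextColumn ju iu qu jc ic iu<r ic+1≮r u≺c | no ju≢jc with suc ju ℕₚ.≟ jc
  ... | yes refl rewrite dec-no (ju ℕₚ.≟ suc (suc ju)) n≢2+n | dec-no (suc ju ℕₚ.≟ suc (suc ju)) n≢1+n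
    with ℕₚ.<-cmp iu ic
  ...   | tri< _ _ _  rewrite deadL≡ᵇrowL {0} {1} 0<rows 1<2 = refl
  ...   | tri≈ _ _ _  rewrite ∧-zeroʳ (secondPlus qu) | deadL≡ᵇrowL {0} {1} 0<rows 1<2 = refl
  ...   | tri> _ _ gt = ⊥-elim (ic+1≮r (ℕₚ.≤-<-trans gt iu<r))
  labelBefore-nextColumn ju iu qu jc ic iu<r ic+1≮r u≺c | no ju≢jc | no _ with ju ℕₚ.≟ suc jc
  ... | yes eq = ⊥-elim (ℕₚ.<-irrefl refl (subst (_≤ jc) eq (≺⇒major≤ u≺c)))
  ... | no _ with suc ju ℕₚ.≟ suc jc
  ...   | yes eq = ⊥-elim (ju≢jc (ℕₚ.suc-injective eq))
  ...   | no _ rewrite deadL≡ᵇrowL {0} {1} 0<rows 1<2 = refl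

  labelBefore-next : ∀ pu pc → InRange pu → InRange pc → pu ≺ pc →
    labelBefore pu (next pc) ≡ applyRelabels (relabelsAfter pc) (labelBefore pu pc)
  labelBefore-next pu (pos jc ic 0) (iu<r , _) _ _
    rewrite ≤deadL⇒≡ᵇnewL (labelBefore≤deadL pu (pos jc ic 0) iu<r) = labelBefore-quad pu jc ic 1 0 refl
  labelBefore-next pu (pos jc ic 2) (iu<r , _) _ _
    rewrite ≤deadL⇒≡ᵇnewL (labelBefore≤deadL pu (pos jc ic 2) iu<r) = labelBefore-quad pu jc ic 3 2 refl
  labelBefore-next (pos ju iu qu) (pos jc ic 1) (iu<r , _) (ic<r , _) u≺c
    rewrite relabelsAfter-plusPlus jc ic _ (labelBefore≤deadL (pos ju iu qu) (pos jc ic 1) iu<r)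
    with ju ℕₚ.≟ jc
  ... | yes refl with ≺-sameMajor u≺c
  ...   | inj₁ iu<ic rewrite rowL≡ᵇrowL-row (secondMinus<2 qu) 0<2 (ℕₚ.<⇒≢ iu<ic) = refl
  ...   | inj₂ (refl , s≤s z≤n) rewrite rowL≡ᵇrowL-sign {iu} 1<2 0<2 (λ ()) = refl
  labelBefore-next (pos ju iu qu) (pos jc ic 1) (iu<r , _) (ic<r , _) u≺c | no _ with suc ju ℕₚ.≟ jc
  ... | no _ rewrite deadL≡ᵇrowL ic<r 0<2 = refl
  ... | yes _ with ℕₚ.<-cmp iu ic
  ...   | tri< _ _ _ rewrite deadL≡ᵇrowL ic<r 0<2 = refl
  ...   | tri> _ _ gt rewrite rowL≡ᵇrowL-row (secondMinus<2 qu) 0<2 (λ eq → ℕₚ.<-irrefl (sym eq) gt) = refl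
  ...   | tri≈ _ refl _ rewrite ∧-zeroʳ (secondPlus qu) | ∧-identityʳ (secondPlus qu) with secondPlus qu
  ...     | true  rewrite ≡ᵇ-refl (rowL iu 0) = refl
  ...     | false rewrite deadL≡ᵇrowL ic<r 0<2 = refl
  labelBefore-next (pos ju iu qu) (pos jc ic 3) (iu<r , _) _ u≺c
    rewrite relabelsAfter-last jc ic _ (labelBefore≤deadL (pos ju iu qu) (pos jc ic 3) iu<r)
    with suc ic <? rows
  ... | yes ic+1<r = labelBefore-nextRow ju iu qu jc ic ic+1<r u≺c
  ... | no ic+1≮r  = labelBefore-nextColumn ju iu qu jc ic iu<r ic+1≮r u≺c
  labelBefore-next pu (pos jc ic (suc (suc (suc (suc _))))) _ (_ , s≤s (s≤s (s≤s (s≤s ())))) _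

  labelBefore-created : ∀ p → InRange p → labelBefore p (next p) ≡ applyRelabels (relabelsAfter p) newL
  labelBefore-created (pos ju iu 0) _ rewrite ≟-refl ju | ≡ᵇ-refl newL = refl
  labelBefore-created (pos ju iu 1) (iu<r , _) rewrite ≟-refl ju | newL≡ᵇrowL iu<r 0<2 | ≡ᵇ-refl newL = refl
  labelBefore-created (pos ju iu 2) _ rewrite ≟-refl ju | ≡ᵇ-refl newL = refl
  labelBefore-created (pos ju iu 3) _ with suc iu <? rows
  ... | yes _ rewrite ≟-refl ju | ≡ᵇ-refl newL | rowL≡ᵇrowL-row {iu} {suc iu} 1<2 1<2 n≢1+n = refl
  ... | no _ rewrite dec-no (ju ℕₚ.≟ suc ju) n≢1+n | ≟-refl (suc ju) with ℕₚ.<-cmp iu 0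
  ...   | tri≈ _ refl _ rewrite ≡ᵇ-refl newL | ≡ᵇ-refl (rowL 0 1) = refl
  ...   | tri> _ _ 0<iu
    rewrite ≡ᵇ-refl newL | rowL≡ᵇrowL-row {iu} {0} 1<2 1<2 (λ eq → ℕₚ.<-irrefl (sym eq) 0<iu) = refl
  labelBefore-created (pos ju iu (suc (suc (suc (suc _))))) (_ , s≤s (s≤s (s≤s (s≤s ()))))

  posOf : Fin n → Pos
  posOf u = pos (colN u) (rowN u) (quadN u)

  posOf-inRange : ∀ u → InRange (posOf u)
  posOf-inRange u = rowN<r u , quadN<4 u

  adj≡alive : ∀ u w → posOf u ≺ posOf w → u ≢ w → adj G u w ≡ alive (labelBefore (posOf u) (posOf w))
  adj≡alive u w u≺w u≢w with colN u ℕₚ.≟ colN w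
  ... | yes eq rewrite rowL≡ᵇdeadL (rowN<r u) (secondMinus<2 (quadN u)) = adjacent u w u≢w (inj₁ (sameColumn eq))
  ... | no ju≢jw with suc (colN u) ℕₚ.≟ colN w
  ...   | no ¬next rewrite ≡ᵇ-refl deadL =
    nonadjacent u w u≢w (¬BRel-far ju≢jw ¬next) (¬BRel-leftward ju≢jw (≺⇒major≤ u≺w))
  ...   | yes next with ℕₚ.<-cmp (rowN u) (rowN w)
  ...     | tri< iu<iw _ _ rewrite ≡ᵇ-refl deadL =
    nonadjacent u w u≢w (¬BRel ju≢jw (λ _ lt → ℕₚ.<-asym iu<iw lt) (λ _ eq _ _ → ℕₚ.<-irrefl eq iu<iw))
                        (¬BRel-leftward ju≢jw (≺⇒major≤ u≺w))
  ...     | tri> _ _ iw<iu rewrite rowL≡ᵇdeadL (rowN<r u) (secondMinus<2 (quadN u)) =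
    adjacent u w u≢w (inj₁ (lowerRow next iw<iu))
  ...     | tri≈ _ iu≡iw _ with secondPlus (quadN u) in s₂ | firstPlus (quadN w) in s₁
  ...       | true | true rewrite rowL≡ᵇdeadL (rowN<r u) 0<2 =
    adjacent u w u≢w (inj₁ (matchingSigns next iu≡iw (secondPlus⇒sgn₂ u s₂) (firstPlus⇒sgn₁ w s₁)))
  ...       | true | false rewrite ≡ᵇ-refl deadL =
    nonadjacent u w u≢w (¬BRel-firstMinus ju≢jw iu≡iw s₁) (¬BRel-leftward ju≢jw (≺⇒major≤ u≺w))
  ...       | false | _ rewrite ≡ᵇ-refl deadL =
    nonadjacent u w u≢w (¬BRel-secondMinus ju≢jw iu≡iw s₂) (¬BRel-leftward ju≢jw (≺⇒major≤ u≺w))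

  relabelsAfter<K : ∀ p → InRange p → All (LabelPair (2 * rows + 2)) (relabelsAfter p)
  relabelsAfter<K (pos jc ic 0) (ic<r , _) = (newL<K , rowL<K ic<r 1<2) ∷ []
  relabelsAfter<K (pos jc ic 1) (ic<r , _) = (rowL<K ic<r 0<2 , deadL<K) ∷ (newL<K , rowL<K ic<r 0<2) ∷ []
  relabelsAfter<K (pos jc ic 2) (ic<r , _) = (newL<K , rowL<K ic<r 0<2) ∷ []
  relabelsAfter<K (pos jc ic 3) (ic<r , _) = (newL<K , rowL<K ic<r 1<2) ∷ (rowL<K nextRow<r 1<2 , deadL<K) ∷ []
    where
    nextRow<r : nextRow ic < rows
    nextRow<r with suc ic <? rows
    ... | yes ic+1<r = ic+1<r
    ... | no _       = 0<rows
  relabelsAfter<K (pos jc ic (suc (suc (suc (suc _))))) (_ , s≤s (s≤s (s≤s (s≤s ()))))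

  schedule : Schedule G (2 * rows + 2)
  schedule = record
    { stage           = encode ∘ posOf
    ; stages          = encode (pos (k B) 0 0)
    ; stage<stages    = λ u → encode<row (posOf u) _ (posOf-inRange u) (colN<k u)
    ; fresh           = newL
    ; 0<fresh         = ℕₚ.≤-<-trans z≤n deadL<newL
    ; fresh<K         = newL<K
    ; relabelsAfter   = relabelsAfter ∘ decode
    ; relabelsAfter<K = λ c → relabelsAfter<K (decode c) (decode-inRange c)
    ; joinsAt         = λ _ → alive
    ; labelAt         = λ d c → labelBefore (decode d) (decode c)
    ; labelAt-suc     = λ d c d<c → labelBefore-next (decode d) (decode c) (decode-inRange d) (decode-inRange c) (decode-<⇒≺ d<c)
    ; labelAt-created = λ c → labelBefore-created (decode c) (decode-inRange c)
    ; labelAt≢fresh   = λ d c _ →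
        ℕₚ.<⇒≢ (ℕₚ.≤-<-trans (labelBefore≤deadL (decode d) (decode c) (proj₁ (decode-inRange d))) deadL<newL)
    ; adj-earlier     = adj-earlier
    ; adj-sameStage   = adj-sameStage
    }
    where
    decode-posOf : ∀ u → decode (encode (posOf u)) ≡ posOf u
    decode-posOf u = decode-encode (posOf u) (posOf-inRange u)

    adj-earlier : ∀ u w → encode (posOf u) < encode (posOf w) →
      adj G u w ≡ alive (labelBefore (decode (encode (posOf u))) (decode (encode (posOf w))))
    adj-earlier u w lt rewrite decode-posOf u | decode-posOf w =
      adj≡alive u w (encode-<⇒≺ (posOf u) (posOf w) (posOf-inRange u) (posOf-inRange w) lt)
        (λ eq → ℕₚ.<-irrefl (cong (encode ∘ posOf) eq) lt)

    adj-sameStage : ∀ u w → u ≢ w → encode (posOf u) ≡ encode (posOf w) → adj G u w ≡ true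
    adj-sameStage u w u≢w eq =
      adjacent u w u≢w (inj₁ (sameColumn (cong major samePos)))
      where samePos = encode-injective (posOf u) (posOf w) (posOf-inRange u) (posOf-inRange w) eq

corollary30 : ∀ (n : ℕ) (G : Graph n) → 0 < n → IsMixedUnitIntervalGraph G →
    (B : BubbleStructure n) → IsUBubbleModel G B →
    CwdAtMost G ((k B + 3) ⊓ (2 * maxColumnLength B + 2))
corollary30 n G 0<n _ B M with ℕₚ.⊓-sel (k B + 3) (2 * maxColumnLength B + 2)
... | inj₁ eq rewrite eq = Construction.cwdAtMost (RowByRow.schedule G B M 0<n) 0<n
... | inj₂ eq rewrite eq = Construction.cwdAtMost (ColumnByColumn.schedule G B M 0<n) 0<n
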